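{- Let $m\ge 3$ and $s$ be odd positive integers and $n=sm$. Let $$\sigma_1=(1,1,\dots,1,tc^{ -1})r,\qquad \sigma_2=(t,\beta_2,\dots,\beta_n)z\ \text{ with } \beta_i=c^{(-1)^{i-1}(2i-3)}\ (2\le i\le n),\qquad \rho=(1,tc^{ -1},tc^{ -1},\dots,tc^{ -1})z,$$ and set $\eta_1=\sigma_1\sigma_2\rho$, $\eta_2=\sigma_2$, $H=\langle\eta_1,\eta_2\rangle$. Then $\Gamma=C_n[mK_1]$ is the skeleton of a polytopal orientable reflexible map $\mathcal{M}$ of type $\{n,2m\}$ with $\mathrm{Aut}^+(\mathcal{M})=H$.
   Context: $C_n[mK_1]$ has vertex set $\{1,\dots,n\}\times\{1,\dots,m\}$ with $(i_1,j_1)\sim(i_2,j_2)$ iff $i_1\equiv i_2\pm1\pmod n$ (residues mod $n$ represented by $1,\dots,n$, mod $m$ by $1,\dots,m$). For $\alpha_i\in S_m$ and a permutation $x$ of $\{1,\dots,n\}$, $(\alpha_1,\dots,\alpha_n)x$ is the vertex permutation $(i,j)\mapsto(ix,j\alpha_i)$; permutations act on the right, products composed left to right. $c=(1\,2\,\cdots\,m)$, $t\in S_m$ fixes $1$ and swaps $j\leftrightarrow m-j+2$ ($2\le j\le m$), $r=(1\,2\,\cdots\,n)$, $z$ fixes $1$ and swaps $j\leftrightarrow n-j+2$ ($2\le j\le n$). A map is a connected finite graph (skeleton) embedded in a closed surface with open-disk faces; polytopal: each face boundary is a cycle and each edge lies on two distinct faces. Map automorphisms are skeleton automorphisms extending to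 homeomorphisms of the surface. Rotary: vertex stabilisers contain cyclic groups transitive on incident edges and face stabilisers contain cyclic groups transitive on the face's vertices; type $\{p,q\}$: faces have $p$ edges, skeleton is $q$-valent. Reflexible: a face stabiliser also contains a reflection of the face. $\mathrm{Aut}^+(\mathcal{M})$ is the rotational group generated by the distinguished generators (one-step rotation of a base face, and one-step rotation about a base vertex of that face, chosen so that their product is an involution reversing a base edge). -}

module Defs where

open import Data.Nat as ℕ using (ℕ; zero; suc; NonZero; _<_)
open import Data.Integer as ℤ using (ℤ; +_; -_; _-_; 1ℤ)
open import Data.Integer.DivMod using (_%ℕ_; n%ℕd<d)
open import Data.Fin as Fin using (Fin; toℕ; fromℕ<)
open import Data.Product using (Σ; ∃; _×_; _,_; proj₁; proj₂; swap)
open import Data.Sum using (_⊎_)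
open import Data.Empty using (⊥)
open import Data.Bool using (true; false)
open import Relation.Nullary using (¬_; yes; no)
open import Relation.Binary.PropositionalEquality using (_≡_; _≢_)
open import Function using (Injective; _∘_; id)

iter : {A : Set} → (A → A) → ℕ → A → A
iter f zero    x = x
iter f (suc k) x = f (iter f k x)

infixl 9 _⨾_
_⨾_ : {A : Set} → (A → A) → (A → A) → A → A
(f ⨾ g) x = g (f x)

modF : (k : ℕ) .{{_ : NonZero k}} → ℤ → Fin k
modF k x = fromℕ< (n%ℕd<d x k)

alt : ℕ → ℤ → ℤ
alt zero    x = x
alt (suc i) x = - alt i x

-- the subgroup generated by two permutations of a finite set:
-- words in the generators (for permutations of a finite set the
-- monoid generated equals the group generated)
data Word : Set where
  ε  : Word
  g₁ : Word → Word
  g₂ : Word → Word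

evalW : {A : Set} → (A → A) → (A → A) → Word → A → A
evalW a b ε      = id
evalW a b (g₁ w) = a ⨾ evalW a b w
evalW a b (g₂ w) = b ⨾ evalW a b w

InGen : {A : Set} → (A → A) → (A → A) → (A → A) → Set
InGen a b f = ∃ λ w → ∀ x → evalW a b w x ≡ f x

-- The graph C_n[mK_1].  Indices are 0-based: paper's i ∈ {1..n} is
-- the element i-1 of Fin n, paper's j ∈ {1..m} is j-1 of Fin m.

module Lex (n m : ℕ) .{{_ : NonZero n}} .{{_ : NonZero m}} where

  V : Set
  V = Fin n × Fin m

  Adj : V → V → Set
  Adj (i₁ , _) (i₂ , _) =
    (i₁ ≡ modF n (+ toℕ i₂ ℤ.+ 1ℤ)) ⊎ (i₂ ≡ modF n (+ toℕ i₁ ℤ.+ 1ℤ))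

  c : Fin m → Fin m
  c j = modF m (+ toℕ j ℤ.+ 1ℤ)

  cPow : ℤ → Fin m → Fin m
  cPow k j = modF m (+ toℕ j ℤ.+ k)

  t : Fin m → Fin m
  t j = modF m (- (+ toℕ j))

  tc⁻¹ : Fin m → Fin m
  tc⁻¹ = t ⨾ cPow (- 1ℤ)

  r : Fin n → Fin n
  r i = modF n (+ toℕ i ℤ.+ 1ℤ)

  z : Fin n → Fin n
  z i = modF n (- (+ toℕ i))

  -- (α₁,…,αₙ)x : (i,j) ↦ (ix , jαᵢ)
  act : (Fin n → Fin m → Fin m) → (Fin n → Fin n) → V → V
  act α x (i , j) = (x i , α i j)

  σ₁ : V → V
  σ₁ = act α r
    where
    α : Fin n → Fin m → Fin m
    α i with toℕ i ℕ.≟ ℕ.pred n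
    ... | yes _ = tc⁻¹
    ... | no  _ = id

  -- βᵢ = c^{(-1)^{i-1}(2i-3)} for paper index i = i'+1 ≥ 2
  β : ℕ → Fin m → Fin m
  β i' = cPow (alt i' (+ (2 ℕ.* i') - 1ℤ))

  σ₂ : V → V
  σ₂ = act α z
    where
    α : Fin n → Fin m → Fin m
    α i with toℕ i
    ... | zero   = t
    ... | suc i' = β (suc i')

  ρ : V → V
  ρ = act α z
    where
    α : Fin n → Fin m → Fin m
    α i with toℕ i
    ... | zero  = id
    ... | suc _ = tc⁻¹

  η₁ η₂ : V → V
  η₁ = σ₁ ⨾ σ₂ ⨾ ρ
  η₂ = σ₂

  -- Orientable maps with skeleton Γ = C_n[mK_1], given combinatorially
  -- by a rotation system: for each vertex u a cyclic permutation
  -- rot u of the neighbours of u (Γ is simple, so darts = ordered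
  -- pairs of adjacent vertices, edges at u = neighbours of u).

  record RotSys : Set where
    field
      rot     : V → V → V
      rot-adj : ∀ u v → Adj u v → Adj u (rot u v)
      rot-inj : ∀ u v w → Adj u v → Adj u w → rot u v ≡ rot u w → v ≡ w
      rot-cyc : ∀ u v w → Adj u v → Adj u w → ∃ λ k → iter (rot u) k v ≡ w

  Dart : Set
  Dart = V × V

  module _ (M : RotSys) where
    open RotSys M

    -- face-traversal permutation on darts
    φ : Dart → Dart
    φ (u , v) = (v , rot v u)

    fv : Dart → ℕ → V
    fv d k = proj₁ (iter φ k d)

    IsDart : Dart → Set
    IsDart (u , v) = Adj u v

    FaceLength : Dart → ℕ → Set
    FaceLength d p = iter φ p d ≡ d × (∀ k → 0 < k → k < p → iter φ k d ≢ d)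

    -- polytopal: each face boundary is a cycle (its p vertices are
    -- distinct) and each edge lies on two distinct faces
    Polytopal : Set
    Polytopal = ∀ d → IsDart d →
      (∃ λ p → FaceLength d p ×
         (∀ k l → k < p → l < p → fv d k ≡ fv d l → k ≡ l))
      × (∀ k → iter φ k d ≢ swap d)

    Degree : V → ℕ → Set
    Degree u q = Σ (Fin q → V) λ f → Injective {A = Fin q} {B = V} _≡_ _≡_ f
      × (∀ k → Adj u (f k)) × (∀ v → Adj u v → ∃ λ k → f k ≡ v)

    HasType : ℕ → ℕ → Set
    HasType p q = (∀ d → IsDart d → FaceLength d p) × (∀ u → Degree u q)

    IsGraphAut : (V → V) → Set
    IsGraphAut f = (∃ λ (g : V → V) → (∀ x → g (f x) ≡ x) × (∀ x → f (g x) ≡ x))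
      × (∀ u v → (Adj u v → Adj (f u) (f v)) × (Adj (f u) (f v) → Adj u v))

    -- map automorphisms: skeleton automorphisms extending to
    -- homeomorphisms, i.e. preserving (orientation-preserving) or
    -- inverting (orientation-reversing) the rotation system
    IsAut⁺ : (V → V) → Set
    IsAut⁺ f = IsGraphAut f × (∀ u v → Adj u v → f (rot u v) ≡ rot (f u) (f v))

    IsAut⁻ : (V → V) → Set
    IsAut⁻ f = IsGraphAut f × (∀ u v → Adj u v → rot (f u) (f (rot u v)) ≡ f v)

    IsAut : (V → V) → Set
    IsAut f = IsAut⁺ f ⊎ IsAut⁻ f

    StabFace : (V → V) → Dart → Set
    StabFace f d = ∀ j → ∃ λ k →
        (f (fv d j) ≡ fv d k × f (fv d (suc j)) ≡ fv d (suc k))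
      ⊎ (f (fv d j) ≡ fv d (suc k) × f (fv d (suc j)) ≡ fv d k)

    ReflectsFace : (V → V) → Dart → Set
    ReflectsFace f d = ∀ j → ∃ λ k →
      f (fv d j) ≡ fv d (suc k) × f (fv d (suc j)) ≡ fv d k

    Rotary : Set
    Rotary =
      (∀ u → ∃ λ g → IsAut g × g u ≡ u ×
         (∀ v w → Adj u v → Adj u w → ∃ λ k → iter g k v ≡ w))
      × (∀ d → IsDart d → ∃ λ g → IsAut g × StabFace g d ×
         (∀ k → ∃ λ e → iter g e (fv d 0) ≡ fv d k))

    Reflexible : Set
    Reflexible = Rotary ×
      (∃ λ d → IsDart d × ∃ λ g → IsAut g × StabFace g d × ReflectsFace g d)

    -- R, S are distinguished generators: R a one-step rotation of a
    -- base face (face of dart d), S a one-step rotation about the base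
    -- vertex fv d 0 of that face, and R S an involution reversing a
    -- base edge (an edge of the base face through the base vertex)
    Distinguished : (V → V) → (V → V) → Set
    Distinguished R S = ∃ λ d → IsDart d × IsAut⁺ R × IsAut⁺ S ×
      ((∀ j → R (fv d j) ≡ fv d (suc j)) ⊎ (∀ j → R (fv d (suc j)) ≡ fv d j)) ×
      (S (fv d 0) ≡ fv d 0 ×
        ((∀ v → Adj (fv d 0) v → S v ≡ rot (fv d 0) v)
         ⊎ (∀ v → Adj (fv d 0) v → rot (fv d 0) (S v) ≡ v))) ×
      (∀ x → (R ⨾ S ⨾ R ⨾ S) x ≡ x) ×
      (∃ λ k → (fv d k ≡ fv d 0 ⊎ fv d (suc k) ≡ fv d 0)
        × (R ⨾ S) (fv d k) ≡ fv d (suc k)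
        × (R ⨾ S) (fv d (suc k)) ≡ fv d k)

    -- Aut⁺(M) = H : the rotational group generated by (some choice of)
    -- distinguished generators equals ⟨a , b⟩
    Aut⁺Is : (V → V) → (V → V) → Set
    Aut⁺Is a b = ∃ λ R → ∃ λ S → Distinguished R S ×
      (∀ f → (InGen R S f → InGen a b f) × (InGen a b f → InGen R S f))

{-# OPTIONS --safe #-}

-- Write a vertex (i , j) of C_n[mK_1] (0-based, as in Defs) in the coordinates (i , y) with
-- y = (-1)^i j + offset i, where offset i = i² - [i odd].  In these coordinates η₁ is the
-- translation (i , y) ↦ (i + 1 , y) and η₂ is (i , y) ↦ (-i , -y + 2i² - 2i), and both
-- preserve the rotation system sending the neighbour (i + 1 , k) of (i , y) to (i - 1 , 2y - k)
-- and the neighbour (i - 1 , k) to (i + 1 , 2y - k + 4).  Since m is odd, 4 is invertible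
-- mod m, so the rotation at each vertex is a single 2m-cycle.  Along a face the layer i
-- moves by ±1 at every step, so each face is an n-gon through n distinct layers and never
-- runs along an edge twice.  Because m ∣ n, the maps (i , y) ↦ (i + s , y + κi + c),
-- (a - i , -y + 2i² + κi + c) and (a - i , y + κi + c) are well defined; they are
-- automorphisms (the last one orientation-reversing) and provide the face rotations, the
-- vertex rotations and a reflection of a face.

module Submission where

open import Defs
open import Data.Nat as ℕ using (ℕ; zero; suc; NonZero; _≤_; _*_; _%_)
import Data.Nat.Properties as ℕ
import Data.Nat.Divisibility as ℕ
import Data.Nat.DivMod as ℕ
open import Data.Nat.Tactic.RingSolver as ℕ-Solver using ()
open import Data.Integer as ℤ using (ℤ; +_; -_; _-_; _+_; 0ℤ; 1ℤ; -1ℤ) renaming (_*_ to _·_)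
import Data.Integer.Properties as ℤ
open import Data.Integer.DivMod using (_%ℕ_; _/ℕ_; n%ℕd<d; a≡a%ℕn+[a/ℕn]*n)
open import Data.Integer.Divisibility.Signed
  using (_∣_; divides; ∣ᵤ⇒∣; ∣⇒∣ᵤ; ∣-trans; ∣m∣n⇒∣m+n; ∣m⇒∣-m; ∣n⇒∣m*n; ∣m⇒∣m*n)
open import Data.Integer.Tactic.RingSolver using (solve)
open import Data.Fin as Fin using (Fin; toℕ)
import Data.Fin.Properties as Fin
open import Data.List using (_∷_; [])
open import Data.Product using (∃; _×_; _,_; proj₁; proj₂; swap; uncurry)
open import Data.Sum as Sum using (_⊎_; inj₁; inj₂)
open import Data.Empty using (⊥-elim)
open import Function using (id; _∘_)
open import Level using (0ℓ)
open import Relation.Nullary using (¬_; Dec; yes; no)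
open import Relation.Binary.Bundles using (Setoid)
import Relation.Binary.Reasoning.Setoid as SetoidReasoning
open import Relation.Binary.PropositionalEquality

-- A record rather than a synonym for + k ∣ a - b, so that a and b can be recovered by
-- unification.
infix 4 _≡_mod_
record _≡_mod_ (a b : ℤ) (k : ℕ) : Set where
  constructor divides-difference
  field k∣a-b : + k ∣ a - b
open _≡_mod_

module _ {k : ℕ} where

  ∣⇒≡-mod : ∀ {x a b} → + k ∣ x → x ≡ a - b → a ≡ b mod k
  ∣⇒≡-mod k∣x refl = divides-difference k∣x

  ≡-mod-reflexive : ∀ {a b} → a ≡ b → a ≡ b mod k
  ≡-mod-reflexive {a} refl = ∣⇒≡-mod (divides 0ℤ refl) (sym (ℤ.+-inverseʳ a))

  ≡-mod-refl : ∀ {a} → a ≡ a mod k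
  ≡-mod-refl = ≡-mod-reflexive refl

  ≡-mod-sym : ∀ {a b} → a ≡ b mod k → b ≡ a mod k
  ≡-mod-sym {a} {b} (divides-difference a≡b) = ∣⇒≡-mod (∣m⇒∣-m a≡b) (solve (a ∷ b ∷ []))

  ≡-mod-trans : ∀ {a b c} → a ≡ b mod k → b ≡ c mod k → a ≡ c mod k
  ≡-mod-trans {a} {b} {c} (divides-difference a≡b) (divides-difference b≡c) =
    ∣⇒≡-mod (∣m∣n⇒∣m+n a≡b b≡c) (solve (a ∷ b ∷ c ∷ []))

  +-cong-mod : ∀ {a b c d} → a ≡ b mod k → c ≡ d mod k → a + c ≡ b + d mod k
  +-cong-mod {a} {b} {c} {d} (divides-difference a≡b) (divides-difference c≡d) =
    ∣⇒≡-mod (∣m∣n⇒∣m+n a≡b c≡d) (solve (a ∷ b ∷ c ∷ d ∷ []))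

  -‿cong-mod : ∀ {a b} → a ≡ b mod k → - a ≡ - b mod k
  -‿cong-mod {a} {b} (divides-difference a≡b) = ∣⇒≡-mod (∣m⇒∣-m a≡b) (solve (a ∷ b ∷ []))

  ·-cong-mod : ∀ {a b c d} → a ≡ b mod k → c ≡ d mod k → a · c ≡ b · d mod k
  ·-cong-mod {a} {b} {c} {d} (divides-difference a≡b) (divides-difference c≡d) =
    ∣⇒≡-mod (∣m∣n⇒∣m+n (∣n⇒∣m*n a c≡d) (∣m⇒∣m*n d a≡b)) (solve (a ∷ b ∷ c ∷ d ∷ []))

  +-congˡ-mod : ∀ c {a b} → a ≡ b mod k → c + a ≡ c + b mod k
  +-congˡ-mod c = +-cong-mod (≡-mod-refl {c})

  +-congʳ-mod : ∀ c {a b} → a ≡ b mod k → a + c ≡ b + c mod k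
  +-congʳ-mod c a≡b = +-cong-mod a≡b (≡-mod-refl {c})

  ·-congˡ-mod : ∀ c {a b} → a ≡ b mod k → c · a ≡ c · b mod k
  ·-congˡ-mod c = ·-cong-mod (≡-mod-refl {c})

  multiple≡0-mod : ∀ q → q · + k ≡ 0ℤ mod k
  multiple≡0-mod q = ∣⇒≡-mod (divides q refl) (sym (ℤ.+-identityʳ (q · + k)))

  k≡0-mod : + k ≡ 0ℤ mod k
  k≡0-mod = ∣⇒≡-mod (divides 1ℤ (sym (ℤ.*-identityˡ (+ k)))) (sym (ℤ.+-identityʳ (+ k)))

≡-mod-setoid : ℕ → Setoid 0ℓ 0ℓ
≡-mod-setoid k = record
  { Carrier = ℤ
  ; _≈_ = λ a b → a ≡ b mod k
  ; isEquivalence = record { refl = ≡-mod-refl ; sym = ≡-mod-sym ; trans = ≡-mod-trans }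
  }

module ≡-mod-Reasoning (k : ℕ) = SetoidReasoning (≡-mod-setoid k)

+-cancelʳ-mod : ∀ {k} c {a b} → a + c ≡ b + c mod k → a ≡ b mod k
+-cancelʳ-mod {k} c {a} {b} eq = begin
  a            ≡⟨ solve (a ∷ c ∷ []) ⟩
  a + c - c    ≈⟨ +-congʳ-mod (- c) eq ⟩
  b + c - c    ≡⟨ solve (b ∷ c ∷ []) ⟩
  b            ∎
  where open ≡-mod-Reasoning k

≡-mod-∣ : ∀ {m n a b} → m ℕ.∣ n → a ≡ b mod n → a ≡ b mod m
≡-mod-∣ m∣n (divides-difference a≡b) = divides-difference (∣-trans (∣ᵤ⇒∣ m∣n) a≡b)

-- Opaque so that integer expressions in toℤ x stay stuck on toℤ x instead of unfolding
-- into toℕ, which would defeat unification and the ring solver.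
opaque
  toℤ : ∀ {k} → Fin k → ℤ
  toℤ x = + toℕ x

  toℤ-def : ∀ {k} (x : Fin k) → toℤ x ≡ + toℕ x
  toℤ-def x = refl

module _ {k : ℕ} .{{_ : NonZero k}} where

  ∣-<⇒≡0 : ∀ {x} → k ℕ.∣ x → x ℕ.< k → x ≡ 0
  ∣-<⇒≡0 {zero}  _   _   = refl
  ∣-<⇒≡0 {suc _} k∣x x<k = ⊥-elim (ℕ.>⇒∤ x<k k∣x)

  <-≡-mod⇒≡ : ∀ {r s} → r ℕ.< k → s ℕ.< k → + r ≡ + s mod k → r ≡ s
  <-≡-mod⇒≡ {r} {s} r<k s<k r≡s = ℤ.+-injective (ℤ.i-j≡0⇒i≡j (+ r) (+ s) (ℤ.∣i∣≡0⇒i≡0 ∣r-s∣≡0))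
    where
    ∣r-s∣≡∣r⊖s∣ : ℤ.∣ + r - + s ∣ ≡ ℤ.∣ r ℤ.⊖ s ∣
    ∣r-s∣≡∣r⊖s∣ = cong ℤ.∣_∣ (ℤ.m-n≡m⊖n r s)
    ∣r-s∣<k : ℤ.∣ + r - + s ∣ ℕ.< k
    ∣r-s∣<k = ℕ.≤-<-trans (ℕ.≤-reflexive ∣r-s∣≡∣r⊖s∣)
                (ℕ.≤-<-trans (ℤ.∣m⊝n∣≤m⊔n r s) (ℕ.⊔-lub r<k s<k))
    ∣r-s∣≡0 : ℤ.∣ + r - + s ∣ ≡ 0
    ∣r-s∣≡0 = ∣-<⇒≡0 (∣⇒∣ᵤ (k∣a-b r≡s)) ∣r-s∣<k

  opaque
    unfolding toℤ

    toℤ-modF : ∀ a → toℤ (modF k a) ≡ a mod k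
    toℤ-modF a = divides-difference (divides (- (a /ℕ k)) (begin
      toℤ (modF k a) - a      ≡⟨ cong (λ x → + x - a) (Fin.toℕ-fromℕ< (n%ℕd<d a k)) ⟩
      + (a %ℕ k) - a          ≡⟨ cong (λ x → + (a %ℕ k) - x) (a≡a%ℕn+[a/ℕn]*n a k) ⟩
      + (a %ℕ k) - (+ (a %ℕ k) + a /ℕ k · + k) ≡⟨ lemma (+ (a %ℕ k)) (a /ℕ k) (+ k) ⟩
      - (a /ℕ k) · + k        ∎))
      where
      open ≡-Reasoning
      lemma : ∀ r q k → r - (r + q · k) ≡ - q · k
      lemma r q k = solve (r ∷ q ∷ k ∷ [])

    modF-cong : ∀ {a b} → a ≡ b mod k → modF k a ≡ modF k b
    modF-cong {a} {b} a≡b = Fin.toℕ-injective (<-≡-mod⇒≡ (Fin.toℕ<n _) (Fin.toℕ<n _)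
      (≡-mod-trans (toℤ-modF a) (≡-mod-trans a≡b (≡-mod-sym (toℤ-modF b)))))

    modF-toℤ : (x : Fin k) → modF k (toℤ x) ≡ x
    modF-toℤ x = Fin.toℕ-injective (<-≡-mod⇒≡ (Fin.toℕ<n _) (Fin.toℕ<n x) (toℤ-modF (toℤ x)))

    toℕ-modF : ∀ {a v} → v ℕ.< k → a ≡ + v mod k → toℕ (modF k a) ≡ v
    toℕ-modF {a} v<k a≡v = <-≡-mod⇒≡ (Fin.toℕ<n _) v<k (≡-mod-trans (toℤ-modF a) a≡v)

  modF-injective : ∀ {a b} → modF k a ≡ modF k b → a ≡ b mod k
  modF-injective {a} {b} eq = ≡-mod-trans (≡-mod-sym (toℤ-modF a))
    (≡-mod-trans (≡-mod-reflexive (cong toℤ eq)) (toℤ-modF b))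

  toℤ-injective-mod : ∀ {x y : Fin k} → toℤ x ≡ toℤ y mod k → x ≡ y
  toℤ-injective-mod {x} {y} x≡y = trans (sym (modF-toℤ x)) (trans (modF-cong x≡y) (modF-toℤ y))

+-suc : ∀ k → + suc k ≡ + k + 1ℤ
+-suc k = trans (cong +_ (ℕ.+-comm 1 k)) (ℤ.pos-+ k 1)

sgn : ℕ → ℤ
sgn k = alt k 1ℤ

alt≡sgn· : ∀ k x → alt k x ≡ sgn k · x
alt≡sgn· zero    x = sym (ℤ.*-identityˡ x)
alt≡sgn· (suc k) x = trans (cong -_ (alt≡sgn· k x)) (ℤ.neg-distribˡ-* (sgn k) x)

sgn·sgn : ∀ k → sgn k · sgn k ≡ 1ℤ
sgn·sgn zero    = refl
sgn·sgn (suc k) = trans (lemma (sgn k)) (sgn·sgn k)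
  where
  lemma : ∀ s → - s · - s ≡ s · s
  lemma s = solve (s ∷ [])

alt-+ : ∀ a b x → alt (a ℕ.+ b) x ≡ alt a (alt b x)
alt-+ zero    b x = refl
alt-+ (suc a) b x = cong -_ (alt-+ a b x)

alt-involutive : ∀ k x → alt k (alt k x) ≡ x
alt-involutive k x = begin
  alt k (alt k x)       ≡⟨ trans (alt≡sgn· k _) (cong (sgn k ·_) (alt≡sgn· k x)) ⟩
  sgn k · (sgn k · x)   ≡⟨ ℤ.*-assoc (sgn k) (sgn k) x ⟨
  sgn k · sgn k · x     ≡⟨ cong (_· x) (sgn·sgn k) ⟩
  1ℤ · x                ≡⟨ ℤ.*-identityˡ x ⟩
  x                     ∎
  where open ≡-Reasoning

sgn-+ : ∀ a b → sgn (a ℕ.+ b) ≡ sgn a · sgn b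
sgn-+ a b = trans (alt-+ a b 1ℤ) (alt≡sgn· a (sgn b))

sgn-double : ∀ h → sgn (h ℕ.+ h) ≡ 1ℤ
sgn-double h = trans (alt-+ h h 1ℤ) (alt-involutive h 1ℤ)

-- offset k = k² - [k odd]; the recursion is exactly what makes η₁ a translation.
offset : ℕ → ℤ
offset zero    = 0ℤ
offset (suc k) = offset k + + 2 · + k + 1ℤ - sgn k

2·offset : ∀ k → + 2 · offset k ≡ + 2 · (+ k · + k) - 1ℤ + sgn k
2·offset zero    = refl
2·offset (suc k) = begin
  + 2 · (offset k + + 2 · + k + 1ℤ - sgn k)              ≡⟨ lemma (offset k) (+ k) (sgn k) ⟩
  + 2 · offset k + + 4 · + k + + 2 - + 2 · sgn k
    ≡⟨ cong (λ x → x + + 4 · + k + + 2 - + 2 · sgn k) (2·offset k) ⟩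
  + 2 · (+ k · + k) - 1ℤ + sgn k + + 4 · + k + + 2 - + 2 · sgn k ≡⟨ lemma′ (+ k) (sgn k) ⟩
  + 2 · ((1ℤ + + k) · (1ℤ + + k)) - 1ℤ - sgn k           ∎
  where
  open ≡-Reasoning
  lemma : ∀ d k s → + 2 · (d + + 2 · k + 1ℤ - s) ≡ + 2 · d + + 4 · k + + 2 - + 2 · s
  lemma d k s = solve (d ∷ k ∷ s ∷ [])
  lemma′ : ∀ k s → + 2 · (k · k) - 1ℤ + s + + 4 · k + + 2 - + 2 · s ≡ + 2 · ((1ℤ + k) · (1ℤ + k)) - 1ℤ - s
  lemma′ k s = solve (k ∷ s ∷ [])

offset-double : ∀ h → offset (h ℕ.+ h) ≡ + (h ℕ.+ h) · + (h ℕ.+ h)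
offset-double h = ℤ.*-cancelˡ-≡ (+ 2) _ _ (begin
  + 2 · offset (h ℕ.+ h)          ≡⟨ 2·offset (h ℕ.+ h) ⟩
  + 2 · (H · H) - 1ℤ + sgn (h ℕ.+ h) ≡⟨ cong (λ s → + 2 · (H · H) - 1ℤ + s) (sgn-double h) ⟩
  + 2 · (H · H) - 1ℤ + 1ℤ         ≡⟨ lemma (H · H) ⟩
  + 2 · (H · H)                   ∎)
  where
  open ≡-Reasoning
  H = + (h ℕ.+ h)
  lemma : ∀ x → + 2 · x - 1ℤ + 1ℤ ≡ + 2 · x
  lemma x = solve (x ∷ [])

offset-+ : ∀ a b → sgn a ≡ - sgn b → offset a + offset b ≡ + a · + a + + b · + b - 1ℤ
offset-+ a b sgn-opposite = ℤ.*-cancelˡ-≡ (+ 2) _ _ (begin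
  + 2 · (offset a + offset b)                                  ≡⟨ ℤ.*-distribˡ-+ (+ 2) (offset a) (offset b) ⟩
  + 2 · offset a + + 2 · offset b                              ≡⟨ cong₂ _+_ (2·offset a) (2·offset b) ⟩
  + 2 · (A · A) - 1ℤ + sgn a + (+ 2 · (B · B) - 1ℤ + sgn b)
    ≡⟨ cong (λ s → + 2 · (A · A) - 1ℤ + s + (+ 2 · (B · B) - 1ℤ + sgn b)) sgn-opposite ⟩
  + 2 · (A · A) - 1ℤ - sgn b + (+ 2 · (B · B) - 1ℤ + sgn b)  ≡⟨ lemma A B (sgn b) ⟩
  + 2 · (A · A + B · B - 1ℤ)                                   ∎)
  where
  open ≡-Reasoning
  A = + a
  B = + b
  lemma : ∀ a b s → + 2 · (a · a) - 1ℤ - s + (+ 2 · (b · b) - 1ℤ + s) ≡ + 2 · (a · a + b · b - 1ℤ)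
  lemma a b s = solve (a ∷ b ∷ s ∷ [])

alt-cong-mod : ∀ {k} i {a b} → a ≡ b mod k → alt i a ≡ alt i b mod k
alt-cong-mod {k} i {a} {b} a≡b = begin
  alt i a      ≡⟨ alt≡sgn· i a ⟩
  sgn i · a    ≈⟨ ·-congˡ-mod (sgn i) a≡b ⟩
  sgn i · b    ≡⟨ alt≡sgn· i b ⟨
  alt i b      ∎
  where open ≡-mod-Reasoning k

drop-sgn² : ∀ k y c → y + c · (1ℤ - sgn k · sgn k) ≡ y
drop-sgn² k y c = trans (cong (λ s → y + c · (1ℤ - s)) (sgn·sgn k)) (lemma y c)
  where
  lemma : ∀ y c → y + c · (1ℤ - 1ℤ) ≡ y
  lemma y c = solve (y ∷ c ∷ [])

fibre : ℕ → ℤ → ℤ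
fibre k x = alt k x + offset k

fibre-cong-mod : ∀ {m} k {x y} → x ≡ y mod m → fibre k x ≡ fibre k y mod m
fibre-cong-mod k x≡y = +-congʳ-mod (offset k) (alt-cong-mod k x≡y)

fibre-suc : ∀ k x → fibre (suc k) (- (x + alt (suc k) (+ 2 · (1ℤ + + k) - 1ℤ)) - 1ℤ) ≡ fibre k x
fibre-suc k x = begin
  - alt k (- (x + - alt k (+ 2 · (1ℤ + K) - 1ℤ)) - 1ℤ) + (offset k + + 2 · K + 1ℤ - S)
    ≡⟨ cong (λ y → - alt k (- (x + - y) - 1ℤ) + (offset k + + 2 · K + 1ℤ - S)) (alt≡sgn· k _) ⟩
  - alt k (- (x + - (S · (+ 2 · (1ℤ + K) - 1ℤ))) - 1ℤ) + (offset k + + 2 · K + 1ℤ - S)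
    ≡⟨ cong (λ y → - y + (offset k + + 2 · K + 1ℤ - S)) (alt≡sgn· k _) ⟩
  - (S · (- (x + - (S · (+ 2 · (1ℤ + K) - 1ℤ))) - 1ℤ)) + (offset k + + 2 · K + 1ℤ - S)
    ≡⟨ lemma S x K (offset k) ⟩
  S · x + offset k + (+ 2 · K + 1ℤ) · (1ℤ - S · S)
    ≡⟨ drop-sgn² k (S · x + offset k) (+ 2 · K + 1ℤ) ⟩
  S · x + offset k
    ≡⟨ cong (_+ offset k) (alt≡sgn· k x) ⟨
  alt k x + offset k ∎
  where
  open ≡-Reasoning
  S = sgn k
  K = + k
  lemma : ∀ S x K D → - (S · (- (x + - (S · (+ 2 · (1ℤ + K) - 1ℤ))) - 1ℤ)) + (D + + 2 · K + 1ℤ - S)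
                      ≡ S · x + D + (+ 2 · K + 1ℤ) · (1ℤ - S · S)
  lemma S x K D = solve (S ∷ x ∷ K ∷ D ∷ [])

sgn-odd-sum : ∀ a b {h} → a ℕ.+ b ≡ suc (h ℕ.+ h) → sgn a ≡ - sgn b
sgn-odd-sum a b {h} a+b≡2h+1 = begin
  sgn a                         ≡⟨ ℤ.*-identityʳ (sgn a) ⟨
  sgn a · 1ℤ                    ≡⟨ cong (sgn a ·_) (sgn·sgn b) ⟨
  sgn a · (sgn b · sgn b)       ≡⟨ ℤ.*-assoc (sgn a) (sgn b) (sgn b) ⟨
  sgn a · sgn b · sgn b         ≡⟨ cong (_· sgn b) (sgn-+ a b) ⟨
  sgn (a ℕ.+ b) · sgn b         ≡⟨ cong (λ k → sgn k · sgn b) a+b≡2h+1 ⟩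
  - sgn (h ℕ.+ h) · sgn b       ≡⟨ cong (λ s → - s · sgn b) (sgn-double h) ⟩
  -1ℤ · sgn b                   ≡⟨ ℤ.-1*i≡-i (sgn b) ⟩
  - sgn b                       ∎
  where open ≡-Reasoning

fibre-complement : ∀ a w x → sgn w ≡ - sgn a →
                   fibre w (x + alt a (+ 2 · + a - 1ℤ))
                   ≡ - fibre a x + + 2 · (+ a · + a) + - + 2 · + a + (+ w + + a) · (+ w - + a)
fibre-complement a w x sgn-opposite = begin
  alt w (x + alt a C) + offset w
    ≡⟨ cong₂ _+_ (trans (alt≡sgn· w _) (cong (_· (x + alt a C)) sgn-opposite)) offset-w ⟩
  - S · (x + alt a C) + (W · W + A · A - 1ℤ - offset a)
    ≡⟨ cong (λ y → - S · (x + y) + (W · W + A · A - 1ℤ - offset a)) (alt≡sgn· a C) ⟩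
  - S · (x + S · C) + (W · W + A · A - 1ℤ - offset a)
    ≡⟨ lemma S x A W (offset a) ⟩
  - (S · x + offset a) + + 2 · (A · A) + - + 2 · A + (W + A) · (W - A) + (+ 2 · A - 1ℤ) · (1ℤ - S · S)
    ≡⟨ drop-sgn² a _ (+ 2 · A - 1ℤ) ⟩
  - (S · x + offset a) + + 2 · (A · A) + - + 2 · A + (W + A) · (W - A)
    ≡⟨ cong (λ y → - (y + offset a) + + 2 · (A · A) + - + 2 · A + (W + A) · (W - A)) (alt≡sgn· a x) ⟨
  - (alt a x + offset a) + + 2 · (A · A) + - + 2 · A + (W + A) · (W - A) ∎
  where
  open ≡-Reasoning
  S = sgn a
  A = + a
  W = + w
  C = + 2 · A - 1ℤ
  offset-w : offset w ≡ W · W + A · A - 1ℤ - offset a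
  offset-w = trans (lemma″ (offset w) (offset a)) (cong (_- offset a) (offset-+ w a sgn-opposite))
    where
    lemma″ : ∀ d e → d ≡ d + e - e
    lemma″ d e = solve (d ∷ e ∷ [])
  lemma : ∀ S x A W D → - S · (x + S · (+ 2 · A - 1ℤ)) + (W · W + A · A - 1ℤ - D)
                        ≡ - (S · x + D) + + 2 · (A · A) + - + 2 · A + (W + A) · (W - A) + (+ 2 · A - 1ℤ) · (1ℤ - S · S)
  lemma S x A W D = solve (S ∷ x ∷ A ∷ W ∷ D ∷ [])

fibre-double : ∀ h x → fibre (h ℕ.+ h) x ≡ x + + (h ℕ.+ h) · + (h ℕ.+ h)
fibre-double h x = cong₂ _+_ (trans (alt-+ h h x) (alt-involutive h x)) (offset-double h)

iter-conj : ∀ {A : Set} (to from : A → A) → (∀ x → from (to x) ≡ x) → (∀ x → to (from x) ≡ x) →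
            ∀ f k x → iter (to ⨾ f ⨾ from) k x ≡ from (iter f k (to x))
iter-conj to from from∘to to∘from f zero    x = sym (from∘to x)
iter-conj to from from∘to to∘from f (suc k) x =
  cong (from ∘ f) (trans (cong to (iter-conj to from from∘to to∘from f k x)) (to∘from _))

iter-suc : ∀ {A : Set} (f : A → A) k x → iter f (suc k) x ≡ iter f k (f x)
iter-suc f zero    x = refl
iter-suc f (suc k) x = cong f (iter-suc f k x)

iter-cong : ∀ {A : Set} {P : A → Set} {f g : A → A} → (∀ x → P x → f x ≡ g x) → (∀ x → P x → P (g x)) →
            ∀ k x → P x → iter f k x ≡ iter g k x
iter-cong f≡g g-pres zero    x p = refl
iter-cong {P = P} {f} {g} f≡g g-pres (suc k) x p =
  trans (cong f (iter-cong f≡g g-pres k x p)) (f≡g _ (iter-preserves k))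
  where
  iter-preserves : ∀ k → P (iter g k x)
  iter-preserves zero    = p
  iter-preserves (suc k) = g-pres _ (iter-preserves k)

module Maps (n m : ℕ) .{{_ : NonZero n}} .{{_ : NonZero m}} where
  open Lex n m
  open RotSys using (rot)

  record Relabelling : Set where
    field
      to from : V → V
      from∘to : ∀ x → from (to x) ≡ x
      to∘from : ∀ x → to (from x) ≡ x
      to-adj : ∀ {u v} → Adj u v → Adj (to u) (to v)
      from-adj : ∀ {u v} → Adj u v → Adj (from u) (from v)

    to-adj⁻ : ∀ {u v} → Adj (to u) (to v) → Adj u v
    to-adj⁻ {u} {v} a = subst₂ Adj (from∘to u) (from∘to v) (from-adj a)

    conj : (V → V) → V → V
    conj g = to ⨾ g ⨾ from

    dart : Dart → Dart
    dart (u , v) = (to u , to v)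

    dart⁻¹ : Dart → Dart
    dart⁻¹ (u , v) = (from u , from v)

    dart-dart⁻¹ : ∀ d → dart (dart⁻¹ d) ≡ d
    dart-dart⁻¹ (u , v) = cong₂ _,_ (to∘from u) (to∘from v)

    dart-injective : ∀ {d e} → dart d ≡ dart e → d ≡ e
    dart-injective {u , v} {u′ , v′} eq = cong₂ _,_
      (trans (sym (from∘to u)) (trans (cong (from ∘ proj₁) eq) (from∘to u′)))
      (trans (sym (from∘to v)) (trans (cong (from ∘ proj₂) eq) (from∘to v′)))

  walk : (N : RotSys) (X : ℕ → V) → (∀ j → rot N (X (suc j)) (X j) ≡ X (suc (suc j))) →
         ∀ j → iter (φ N) j (X 0 , X 1) ≡ (X j , X (suc j))
  walk N X step zero    = refl
  walk N X step (suc j) = trans (cong (φ N) (walk N X step j)) (cong (X (suc j) ,_) (step j))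

  graphAut : ∀ N f g → (∀ x → g (f x) ≡ x) → (∀ x → f (g x) ≡ x) →
             (∀ u v → Adj u v → Adj (f u) (f v)) → (∀ u v → Adj u v → Adj (g u) (g v)) → IsGraphAut N f
  graphAut N f g g∘f f∘g f-adj g-adj =
    (g , g∘f , f∘g) , λ u v → f-adj u v , λ a → subst₂ Adj (g∘f u) (g∘f v) (g-adj (f u) (f v) a)

  pullback : Relabelling → RotSys → RotSys
  pullback ψ N = record { rot = rot′ ; rot-adj = rot′-adj ; rot-inj = rot′-inj ; rot-cyc = rot′-cyc }
    where
    open Relabelling ψ
    open RotSys N using (rot-adj; rot-inj; rot-cyc)

    rot′ : V → V → V
    rot′ u v = from (rot N (to u) (to v))

    rot′-adj : ∀ u v → Adj u v → Adj u (rot′ u v)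
    rot′-adj u v a = subst (λ x → Adj x (rot′ u v)) (from∘to u) (from-adj (rot-adj (to u) (to v) (to-adj a)))

    rot′-inj : ∀ u v w → Adj u v → Adj u w → rot′ u v ≡ rot′ u w → v ≡ w
    rot′-inj u v w av aw eq = begin
      v                   ≡⟨ from∘to v ⟨
      from (to v)         ≡⟨ cong from (rot-inj (to u) (to v) (to w) (to-adj av) (to-adj aw) to-eq) ⟩
      from (to w)         ≡⟨ from∘to w ⟩
      w                   ∎
      where
      open ≡-Reasoning
      to-eq : rot N (to u) (to v) ≡ rot N (to u) (to w)
      to-eq = trans (sym (to∘from _)) (trans (cong to eq) (to∘from _))

    rot′-cyc : ∀ u v w → Adj u v → Adj u w → ∃ λ k → iter (rot′ u) k v ≡ w
    rot′-cyc u v w av aw with rot-cyc (to u) (to v) (to w) (to-adj av) (to-adj aw)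
    ... | k , eq = k , (begin
      iter (rot′ u) k v               ≡⟨ iter-conj to from from∘to to∘from (rot N (to u)) k v ⟩
      from (iter (rot N (to u)) k (to v)) ≡⟨ cong from eq ⟩
      from (to w)                     ≡⟨ from∘to w ⟩
      w                               ∎)
      where open ≡-Reasoning

  module Pullback (ψ : Relabelling) (N : RotSys) where
    open Relabelling ψ

    M : RotSys
    M = pullback ψ N

    from-adj⁻ : ∀ {u v} → Adj (from u) (from v) → Adj u v
    from-adj⁻ {u} {v} a = subst₂ Adj (to∘from u) (to∘from v) (to-adj a)

    iter-φ : ∀ {d d′} → dart d ≡ d′ → ∀ k → iter (φ N) k d′ ≡ dart (iter (φ M) k d)
    iter-φ refl zero    = refl
    iter-φ refl (suc k) = trans (cong (φ N) (iter-φ refl k)) (φ-dart (iter (φ M) k _))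
      where
      φ-dart : ∀ e → φ N (dart e) ≡ dart (φ M e)
      φ-dart (u , v) = cong (to v ,_) (sym (to∘from _))

    fv-to : ∀ {d d′} → dart d ≡ d′ → ∀ k → fv N d′ k ≡ to (fv M d k)
    fv-to eq k = cong proj₁ (iter-φ eq k)

    fv-to-injective : ∀ {d d′} → dart d ≡ d′ → ∀ {k l} → fv N d′ k ≡ fv N d′ l → fv M d k ≡ fv M d l
    fv-to-injective {d} eq {k} {l} e = begin
      fv M d k             ≡⟨ from∘to _ ⟨
      from (to (fv M d k)) ≡⟨ cong from (trans (sym (fv-to eq k)) (trans e (fv-to eq l))) ⟩
      from (to (fv M d l)) ≡⟨ from∘to _ ⟩
      fv M d l             ∎
      where open ≡-Reasoning

    faceLength : ∀ {d d′ p} → dart d ≡ d′ → FaceLength N d′ p → FaceLength M d p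
    faceLength {d} {d′} {p} eq (closes , minimal) = closes′ , minimal′
      where
      closes′ : iter (φ M) p d ≡ d
      closes′ = dart-injective (trans (sym (iter-φ eq p)) (trans closes (sym eq)))
      minimal′ : ∀ k → 0 ℕ.< k → k ℕ.< p → iter (φ M) k d ≢ d
      minimal′ k 0<k k<p e = minimal k 0<k k<p (trans (iter-φ eq k) (trans (cong dart e) eq))

    polytopal : Polytopal N → Polytopal M
    polytopal polytopalN d a with polytopalN (dart d) (to-adj a)
    ... | (p , length , distinct) , no-swap = (p , faceLength refl length , distinct′) , no-swap′
      where
      distinct′ : ∀ k l → k ℕ.< p → l ℕ.< p → fv M d k ≡ fv M d l → k ≡ l
      distinct′ k l k<p l<p e = distinct k l k<p l<p (trans (fv-to refl k) (trans (cong to e) (sym (fv-to refl l))))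
      no-swap′ : ∀ k → iter (φ M) k d ≢ swap d
      no-swap′ k e = no-swap k (trans (iter-φ refl k) (cong dart e))

    hasType : ∀ {p q} → HasType N p q → HasType M p q
    hasType (faces , degree) = (λ d a → faceLength refl (faces (dart d) (to-adj a))) , degree

    conj-graphAut : ∀ {g} → IsGraphAut N g → IsGraphAut M (conj g)
    conj-graphAut {g} ((g⁻¹ , left , right) , adj) = (conj g⁻¹ , inverse g⁻¹ g left , inverse g g⁻¹ right) , adj′
      where
      inverse : ∀ f h → (∀ x → f (h x) ≡ x) → ∀ x → conj f (conj h x) ≡ x
      inverse f h f∘h x = trans (cong (from ∘ f) (to∘from _)) (trans (cong from (f∘h (to x))) (from∘to x))
      adj′ : ∀ u v → (Adj u v → Adj (conj g u) (conj g v)) × (Adj (conj g u) (conj g v) → Adj u v)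
      adj′ u v = (λ a → from-adj (proj₁ (adj (to u) (to v)) (to-adj a)))
               , (λ a → to-adj⁻ (proj₂ (adj (to u) (to v)) (from-adj⁻ a)))

    conj-aut⁺ : ∀ {g} → IsAut⁺ N g → IsAut⁺ M (conj g)
    conj-aut⁺ {g} (graphAut , g-rot) = conj-graphAut graphAut , g-rot′
      where
      g-rot′ : ∀ u v → Adj u v → conj g (rot M u v) ≡ rot M (conj g u) (conj g v)
      g-rot′ u v a = begin
        from (g (to (from (rot N (to u) (to v)))))          ≡⟨ cong (from ∘ g) (to∘from _) ⟩
        from (g (rot N (to u) (to v)))                      ≡⟨ cong from (g-rot (to u) (to v) (to-adj a)) ⟩
        from (rot N (g (to u)) (g (to v)))                  ≡⟨ cong from (cong₂ (rot N) (to∘from _) (to∘from _)) ⟨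
        from (rot N (to (conj g u)) (to (conj g v)))        ∎
        where open ≡-Reasoning

    conj-aut⁻ : ∀ {g} → IsAut⁻ N g → IsAut⁻ M (conj g)
    conj-aut⁻ {g} (graphAut , g-rot) = conj-graphAut graphAut , g-rot′
      where
      g-rot′ : ∀ u v → Adj u v → rot M (conj g u) (conj g (rot M u v)) ≡ conj g v
      g-rot′ u v a = begin
        from (rot N (to (conj g u)) (to (conj g (rot M u v))))    ≡⟨ cong from (cong₂ (rot N) (to∘from _) (to∘from _)) ⟩
        from (rot N (g (to u)) (g (to (from (rot N (to u) (to v))))))
          ≡⟨ cong (λ x → from (rot N (g (to u)) (g x))) (to∘from _) ⟩
        from (rot N (g (to u)) (g (rot N (to u) (to v))))         ≡⟨ cong from (g-rot (to u) (to v) (to-adj a)) ⟩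
        from (g (to v))                                           ∎
        where open ≡-Reasoning

    conj-aut : ∀ {g} → IsAut N g → IsAut M (conj g)
    conj-aut = Sum.map conj-aut⁺ conj-aut⁻

    conj-fv : ∀ {g d d′} → dart d ≡ d′ → ∀ j k → g (fv N d′ j) ≡ fv N d′ k → conj g (fv M d j) ≡ fv M d k
    conj-fv {g} {d} {d′} eq j k e = begin
      from (g (to (fv M d j)))  ≡⟨ cong (from ∘ g) (fv-to eq j) ⟨
      from (g (fv N d′ j))       ≡⟨ cong from (trans e (fv-to eq k)) ⟩
      from (to (fv M d k))      ≡⟨ from∘to _ ⟩
      fv M d k                  ∎
      where open ≡-Reasoning

    conj-stabFace : ∀ {g d d′} → dart d ≡ d′ → StabFace N g d′ → StabFace M (conj g) d
    conj-stabFace {g} {d} {d′} eq stab j with stab j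
    ... | k , inj₁ (e₀ , e₁) = k , inj₁ (conj-fv {g} {d} {d′} eq j k e₀ , conj-fv {g} {d} {d′} eq (suc j) (suc k) e₁)
    ... | k , inj₂ (e₀ , e₁) = k , inj₂ (conj-fv {g} {d} {d′} eq j (suc k) e₀ , conj-fv {g} {d} {d′} eq (suc j) k e₁)

    conj-reflectsFace : ∀ {g d d′} → dart d ≡ d′ → ReflectsFace N g d′ → ReflectsFace M (conj g) d
    conj-reflectsFace {g} {d} {d′} eq reflects j with reflects j
    ... | k , e₀ , e₁ = k , conj-fv {g} {d} {d′} eq j (suc k) e₀ , conj-fv {g} {d} {d′} eq (suc j) k e₁

    conj-iter-fv : ∀ {g d d′} → dart d ≡ d′ → ∀ {e k} → iter g e (fv N d′ 0) ≡ fv N d′ k →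
                   iter (conj g) e (fv M d 0) ≡ fv M d k
    conj-iter-fv {g} {d} {d′} eq {e} {k} p = begin
      iter (conj g) e (fv M d 0)        ≡⟨ iter-conj to from from∘to to∘from g e _ ⟩
      from (iter g e (to (fv M d 0)))   ≡⟨ cong (from ∘ iter g e) (fv-to eq 0) ⟨
      from (iter g e (fv N d′ 0))        ≡⟨ cong from (trans p (fv-to eq k)) ⟩
      from (to (fv M d k))              ≡⟨ from∘to _ ⟩
      fv M d k                          ∎
      where open ≡-Reasoning

    rotary : Rotary N → Rotary M
    rotary (vertexRotations , faceRotations) = vertexRotations′ , faceRotations′
      where
      vertexRotations′ : ∀ u → ∃ λ g →
                         IsAut M g × g u ≡ u × (∀ v w → Adj u v → Adj u w → ∃ λ k → iter g k v ≡ w)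
      vertexRotations′ u with vertexRotations (to u)
      ... | g , aut , fixes , transitive = conj g , conj-aut aut , trans (cong from fixes) (from∘to u) , transitive′
        where
        transitive′ : ∀ v w → Adj u v → Adj u w → ∃ λ k → iter (conj g) k v ≡ w
        transitive′ v w av aw with transitive (to v) (to w) (to-adj av) (to-adj aw)
        ... | k , p = k , trans (iter-conj to from from∘to to∘from g k v) (trans (cong from p) (from∘to w))
      faceRotations′ : ∀ d → IsDart M d → ∃ λ g →
                       IsAut M g × StabFace M g d × (∀ k → ∃ λ e → iter g e (fv M d 0) ≡ fv M d k)
      faceRotations′ d a with faceRotations (dart d) (to-adj a)
      ... | g , aut , stab , transitive = conj g , conj-aut aut , conj-stabFace {g} {d} refl stab
        , λ k → proj₁ (transitive k) , conj-iter-fv {g} {d} refl {proj₁ (transitive k)} {k} (proj₂ (transitive k))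

    reflexible : Reflexible N → Reflexible M
    reflexible (rotaryN , d′ , a , g , aut , stab , reflects) =
      rotary rotaryN , dart⁻¹ d′ , from-adj a , conj g , conj-aut aut
      , conj-stabFace {g} (dart-dart⁻¹ d′) stab , conj-reflectsFace {g} (dart-dart⁻¹ d′) reflects

    conj-⨾ : ∀ f g x → (conj f ⨾ conj g) x ≡ conj (f ⨾ g) x
    conj-⨾ f g x = cong (from ∘ g) (to∘from _)

    conj-involution : ∀ {R S} → (∀ x → (R ⨾ S ⨾ R ⨾ S) x ≡ x) →
                      ∀ x → (conj R ⨾ conj S ⨾ conj R ⨾ conj S) x ≡ x
    conj-involution {R} {S} involution x = begin
      (conj R ⨾ conj S ⨾ conj R ⨾ conj S) x ≡⟨ cong (conj S ∘ conj R ∘ from ∘ S) (to∘from _) ⟩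
      (conj (R ⨾ S) ⨾ conj R ⨾ conj S) x    ≡⟨ cong (conj S ∘ from ∘ R) (to∘from _) ⟩
      (conj (R ⨾ S ⨾ R) ⨾ conj S) x         ≡⟨ cong (from ∘ S) (to∘from _) ⟩
      conj (R ⨾ S ⨾ R ⨾ S) x                ≡⟨ cong from (involution (to x)) ⟩
      from (to x)                           ≡⟨ from∘to x ⟩
      x                                     ∎
      where open ≡-Reasoning

    conj-rotatesFace : ∀ {R d d′} → dart d ≡ d′ →
      (∀ j → R (fv N d′ j) ≡ fv N d′ (suc j)) ⊎ (∀ j → R (fv N d′ (suc j)) ≡ fv N d′ j) →
      (∀ j → conj R (fv M d j) ≡ fv M d (suc j)) ⊎ (∀ j → conj R (fv M d (suc j)) ≡ fv M d j)
    conj-rotatesFace {R} {d} eq =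
      Sum.map (λ r j → conj-fv {R} {d} eq j (suc j) (r j)) (λ r j → conj-fv {R} {d} eq (suc j) j (r j))

    conj-rotatesVertex : ∀ {S d d′} → dart d ≡ d′ →
      (∀ v → Adj (fv N d′ 0) v → S v ≡ rot N (fv N d′ 0) v)
        ⊎ (∀ v → Adj (fv N d′ 0) v → rot N (fv N d′ 0) (S v) ≡ v) →
      (∀ v → Adj (fv M d 0) v → conj S v ≡ rot M (fv M d 0) v)
        ⊎ (∀ v → Adj (fv M d 0) v → rot M (fv M d 0) (conj S v) ≡ v)
    conj-rotatesVertex {S} {d} {d′} eq = Sum.map forward backward
      where
      base : fv N d′ 0 ≡ to (fv M d 0)
      base = fv-to eq 0
      base-adj : ∀ {v} → Adj (fv M d 0) v → Adj (fv N d′ 0) (to v)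
      base-adj {v} a = subst (λ x → Adj x (to v)) (sym base) (to-adj a)
      forward : (∀ v → Adj (fv N d′ 0) v → S v ≡ rot N (fv N d′ 0) v) →
                ∀ v → Adj (fv M d 0) v → conj S v ≡ rot M (fv M d 0) v
      forward s v a = cong from (trans (s (to v) (base-adj a)) (cong (λ x → rot N x (to v)) base))
      backward : (∀ v → Adj (fv N d′ 0) v → rot N (fv N d′ 0) (S v) ≡ v) →
                 ∀ v → Adj (fv M d 0) v → rot M (fv M d 0) (conj S v) ≡ v
      backward s v a = begin
        from (rot N (to (fv M d 0)) (to (from (S (to v))))) ≡⟨ cong from (cong₂ (rot N) (sym base) (to∘from _)) ⟩
        from (rot N (fv N d′ 0) (S (to v)))                 ≡⟨ cong from (s (to v) (base-adj a)) ⟩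
        from (to v)                                         ≡⟨ from∘to v ⟩
        v                                                   ∎
        where open ≡-Reasoning

    distinguished : ∀ {R S} → Distinguished N R S → Distinguished M (conj R) (conj S)
    distinguished {R} {S} (d′ , a , autR , autS , rotatesFace , (fixes , rotatesVertex) , involution , k , at-base , swaps) =
      d , from-adj a , conj-aut⁺ autR , conj-aut⁺ autS , conj-rotatesFace {R} eq rotatesFace
      , (conj-fv {S} {d} eq 0 0 fixes , conj-rotatesVertex {S} eq rotatesVertex) , conj-involution {R} {S} involution
      , k , Sum.map (fv-to-injective eq {k} {0}) (fv-to-injective eq {suc k} {0}) at-base
      , trans (conj-⨾ R S _) (conj-fv {R ⨾ S} {d} eq k (suc k) (proj₁ swaps))
      , trans (conj-⨾ R S _) (conj-fv {R ⨾ S} {d} eq (suc k) k (proj₂ swaps))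
      where
      d = dart⁻¹ d′
      eq = dart-dart⁻¹ d′

  module _ {N : RotSys} where

    graphAut-≗ : ∀ {f g} → f ≗ g → IsGraphAut N f → IsGraphAut N g
    graphAut-≗ {f} {g} f≗g ((f⁻¹ , left , right) , adj) =
      (f⁻¹ , (λ x → trans (cong f⁻¹ (sym (f≗g x))) (left x)) , (λ x → trans (sym (f≗g (f⁻¹ x))) (right x)))
      , λ u v → (λ a → subst₂ Adj (f≗g u) (f≗g v) (proj₁ (adj u v) a))
              , (λ a → proj₂ (adj u v) (subst₂ Adj (sym (f≗g u)) (sym (f≗g v)) a))

    aut⁺-≗ : ∀ {f g} → f ≗ g → IsAut⁺ N f → IsAut⁺ N g
    aut⁺-≗ {f} {g} f≗g (graphAut , f-rot) = graphAut-≗ f≗g graphAut , g-rot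
      where
      g-rot : ∀ u v → Adj u v → g (rot N u v) ≡ rot N (g u) (g v)
      g-rot u v a = trans (sym (f≗g _)) (trans (f-rot u v a) (cong₂ (rot N) (f≗g u) (f≗g v)))

    distinguished-≗ : ∀ {R R′ S S′} → R ≗ R′ → S ≗ S′ → Distinguished N R S → Distinguished N R′ S′
    distinguished-≗ {R} {R′} {S} {S′} R≗R′ S≗S′
      (d , a , autR , autS , rotatesFace , (fixes , rotatesVertex) , involution , (k , at-base , swaps₀ , swaps₁)) =
      d , a , aut⁺-≗ R≗R′ autR , aut⁺-≗ S≗S′ autS
      , Sum.map (λ r j → trans (sym (R≗R′ _)) (r j)) (λ r j → trans (sym (R≗R′ _)) (r j)) rotatesFace
      , (trans (sym (S≗S′ _)) fixes
        , Sum.map (λ s v a → trans (sym (S≗S′ v)) (s v a))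
                  (λ s v a → trans (cong (rot N _) (sym (S≗S′ v))) (s v a)) rotatesVertex)
      , (λ x → trans (sym (RS≗ (S′ (R′ x)))) (trans (cong (S ∘ R) (sym (RS≗ x))) (involution x)))
      , k , at-base , trans (sym (RS≗ _)) swaps₀ , trans (sym (RS≗ _)) swaps₁
      where
      RS≗ : ∀ x → (R ⨾ S) x ≡ (R′ ⨾ S′) x
      RS≗ x = trans (cong S (R≗R′ x)) (S≗S′ _)

    aut⁺Is : ∀ {a b} → Distinguished N a b → Aut⁺Is N a b
    aut⁺Is {a} {b} distinguishedN = a , b , distinguishedN , λ f → id , id

module IntegerPoints (n m : ℕ) .{{_ : NonZero n}} .{{_ : NonZero m}} (m∣n : m ℕ.∣ n) where
  open Lex n m

  ≡-mod-n⇒m : ∀ {a b} → a ≡ b mod n → a ≡ b mod m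
  ≡-mod-n⇒m = ≡-mod-∣ m∣n

  n≡0-mod-m : + n ≡ 0ℤ mod m
  n≡0-mod-m = ≡-mod-n⇒m k≡0-mod

  toℤ-modFₙ : ∀ a → toℤ (modF n a) ≡ a mod m
  toℤ-modFₙ a = ≡-mod-n⇒m (toℤ-modF a)

  r-modF : ∀ a → r (modF n a) ≡ modF n (a + 1ℤ)
  r-modF a = modF-cong (+-cong-mod (subst (_≡ a mod n) (toℤ-def _) (toℤ-modF a)) (≡-mod-refl {a = 1ℤ}))

  r-toℤ : ∀ i → r i ≡ modF n (toℤ i + 1ℤ)
  r-toℤ i = trans (cong r (sym (modF-toℤ i))) (r-modF (toℤ i))

  -- Opaque so that unification can read a and b off ⟪ a , b ⟫.
  opaque
    ⟪_,_⟫ : ℤ → ℤ → V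
    ⟪ a , b ⟫ = (modF n a , modF m b)

    ⟪⟫-def : ∀ a b → ⟪ a , b ⟫ ≡ (modF n a , modF m b)
    ⟪⟫-def a b = refl

    ⟪⟫-cong : ∀ {a a′ b b′} → a ≡ a′ mod n → b ≡ b′ mod m → ⟪ a , b ⟫ ≡ ⟪ a′ , b′ ⟫
    ⟪⟫-cong a≡a′ b≡b′ = cong₂ _,_ (modF-cong a≡a′) (modF-cong b≡b′)

    ⟪⟫-injective : ∀ {a a′ b b′} → ⟪ a , b ⟫ ≡ ⟪ a′ , b′ ⟫ → a ≡ a′ mod n × b ≡ b′ mod m
    ⟪⟫-injective eq = modF-injective (cong proj₁ eq) , modF-injective (cong proj₂ eq)

    ⟪toℤ⟫ : ∀ u → ⟪ toℤ (proj₁ u) , toℤ (proj₂ u) ⟫ ≡ u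
    ⟪toℤ⟫ (i , j) = cong₂ _,_ (modF-toℤ i) (modF-toℤ j)

    adj-above : ∀ {a a′ b b′} → a′ ≡ a + 1ℤ mod n → Adj ⟪ a , b ⟫ ⟪ a′ , b′ ⟫
    adj-above {a} a′≡a+1 = inj₂ (trans (modF-cong a′≡a+1) (sym (r-modF a)))

    adj-below : ∀ {a a′ b b′} → a′ ≡ a - 1ℤ mod n → Adj ⟪ a , b ⟫ ⟪ a′ , b′ ⟫
    adj-below {a} {a′} a′≡a-1 = inj₁ (trans (modF-cong a≡a′+1) (sym (r-modF a′)))
      where
      a≡a′+1 : a ≡ a′ + 1ℤ mod n
      a≡a′+1 = begin
        a               ≡⟨ solve (a ∷ []) ⟩
        a - 1ℤ + 1ℤ     ≈⟨ +-cong-mod (≡-mod-sym a′≡a-1) ≡-mod-refl ⟩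
        a′ + 1ℤ         ∎
        where open ≡-mod-Reasoning n

  points-elim : {P : V → Set} → (∀ a b → P ⟪ a , b ⟫) → ∀ u → P u
  points-elim {P} P⟪⟫ u = subst P (⟪toℤ⟫ u) (P⟪⟫ (toℤ (proj₁ u)) (toℤ (proj₂ u)))

  data Neighbour (a : ℤ) : V → Set where
    above : ∀ c → Neighbour a ⟪ a + 1ℤ , c ⟫
    below : ∀ c → Neighbour a ⟪ a - 1ℤ , c ⟫

  opaque
    unfolding ⟪_,_⟫

    neighbour : ∀ {a b v} → Adj ⟪ a , b ⟫ v → Neighbour a v
    neighbour {a} {b} {i , j} (inj₂ i≡ra) = subst (Neighbour a) (cong₂ _,_ i≡ (modF-toℤ j)) (above (toℤ j))
      where
      i≡ : modF n (a + 1ℤ) ≡ i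
      i≡ = sym (trans i≡ra (r-modF a))
    neighbour {a} {b} {i , j} (inj₁ a≡ri) = subst (Neighbour a) (cong₂ _,_ i≡ (modF-toℤ j)) (below (toℤ j))
      where
      a≡i+1 : a ≡ toℤ i + 1ℤ mod n
      a≡i+1 = begin
        a                            ≈⟨ ≡-mod-sym (toℤ-modF a) ⟩
        toℤ (modF n a)               ≡⟨ cong toℤ a≡ri ⟩
        toℤ (modF n (+ toℕ i + 1ℤ))  ≈⟨ toℤ-modF _ ⟩
        + toℕ i + 1ℤ                 ≡⟨ cong (_+ 1ℤ) (toℤ-def i) ⟨
        toℤ i + 1ℤ                   ∎
        where open ≡-mod-Reasoning n
      i≡ : modF n (a - 1ℤ) ≡ i
      i≡ = trans (modF-cong (begin
        a - 1ℤ              ≈⟨ +-cong-mod a≡i+1 ≡-mod-refl ⟩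
        toℤ i + 1ℤ - 1ℤ     ≡⟨ trans (ℤ.+-assoc (toℤ i) 1ℤ -1ℤ) (ℤ.+-identityʳ (toℤ i)) ⟩
        toℤ i               ∎)) (modF-toℤ i)
        where open ≡-mod-Reasoning n

  adjacent-elim : {P : V → V → Set} → (∀ a b c → P ⟪ a , b ⟫ ⟪ a + 1ℤ , c ⟫) →
                  (∀ a b c → P ⟪ a , b ⟫ ⟪ a - 1ℤ , c ⟫) →
                  ∀ u v → Adj u v → P u v
  adjacent-elim {P} up down = points-elim (λ a b v adj → elim a b (neighbour {a} {b} adj))
    where
    elim : ∀ a b {v} → Neighbour a v → P ⟪ a , b ⟫ v
    elim a b (above c) = up a b c
    elim a b (below c) = down a b c

  n·≡0-mod-m : ∀ x → + n · x ≡ 0ℤ mod m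
  n·≡0-mod-m x = ·-cong-mod n≡0-mod-m (≡-mod-refl {a = x})

  translation-adj : ∀ (f : V → V) s → (∀ a b → ∃ λ (y : ℤ) → f ⟪ a , b ⟫ ≡ ⟪ a + s , y ⟫) →
                    ∀ u v → Adj u v → Adj (f u) (f v)
  translation-adj f s shape = adjacent-elim
    (λ a b c → subst₂ Adj (sym (proj₂ (shape a b))) (sym (proj₂ (shape (a + 1ℤ) c)))
                 (adj-above {a + s} {a + 1ℤ + s} (≡-mod-reflexive (solve (a ∷ s ∷ [])))))
    (λ a b c → subst₂ Adj (sym (proj₂ (shape a b))) (sym (proj₂ (shape (a - 1ℤ) c)))
                 (adj-below {a + s} {a - 1ℤ + s} (≡-mod-reflexive (solve (a ∷ s ∷ [])))))

  reflection-adj : ∀ (f : V → V) s → (∀ a b → ∃ λ (y : ℤ) → f ⟪ a , b ⟫ ≡ ⟪ s - a , y ⟫) →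
                   ∀ u v → Adj u v → Adj (f u) (f v)
  reflection-adj f s shape = adjacent-elim
    (λ a b c → subst₂ Adj (sym (proj₂ (shape a b))) (sym (proj₂ (shape (a + 1ℤ) c)))
                 (adj-below {s - a} {s - (a + 1ℤ)} (≡-mod-reflexive (solve (a ∷ s ∷ [])))))
    (λ a b c → subst₂ Adj (sym (proj₂ (shape a b))) (sym (proj₂ (shape (a - 1ℤ) c)))
                 (adj-above {s - a} {s - (a - 1ℤ)} (≡-mod-reflexive (solve (a ∷ s ∷ [])))))

  glide : ℤ → ℤ → ℤ → V → V
  glide s κ c (i , y) = ⟪ toℤ i + s , toℤ y + κ · toℤ i + c ⟫

  turn : ℤ → ℤ → ℤ → V → V
  turn a₀ κ c (i , y) = ⟪ a₀ - toℤ i , - toℤ y + + 2 · (toℤ i · toℤ i) + κ · toℤ i + c ⟫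

  flip : ℤ → ℤ → ℤ → V → V
  flip a₀ κ c (i , y) = ⟪ a₀ - toℤ i , toℤ y + κ · toℤ i + c ⟫

  glide-⟪⟫ : ∀ s κ c a b → glide s κ c ⟪ a , b ⟫ ≡ ⟪ a + s , b + κ · a + c ⟫
  glide-⟪⟫ s κ c a b = trans (cong (glide s κ c) (⟪⟫-def a b)) (⟪⟫-cong
    (+-congʳ-mod s (toℤ-modF a))
    (+-congʳ-mod c (+-cong-mod (toℤ-modF b) (·-congˡ-mod κ (toℤ-modFₙ a)))))

  turn-⟪⟫ : ∀ a₀ κ c a b → turn a₀ κ c ⟪ a , b ⟫ ≡ ⟪ a₀ - a , - b + + 2 · (a · a) + κ · a + c ⟫
  turn-⟪⟫ a₀ κ c a b = trans (cong (turn a₀ κ c) (⟪⟫-def a b)) (⟪⟫-cong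
    (+-congˡ-mod a₀ (-‿cong-mod (toℤ-modF a)))
    (+-congʳ-mod c (+-cong-mod (+-cong-mod (-‿cong-mod (toℤ-modF b)) (·-congˡ-mod (+ 2) (·-cong-mod a≡ a≡)))
                               (·-congˡ-mod κ a≡))))
    where
    a≡ = toℤ-modFₙ a

  flip-⟪⟫ : ∀ a₀ κ c a b → flip a₀ κ c ⟪ a , b ⟫ ≡ ⟪ a₀ - a , b + κ · a + c ⟫
  flip-⟪⟫ a₀ κ c a b = trans (cong (flip a₀ κ c) (⟪⟫-def a b)) (⟪⟫-cong
    (+-congˡ-mod a₀ (-‿cong-mod (toℤ-modF a)))
    (+-congʳ-mod c (+-cong-mod (toℤ-modF b) (·-congˡ-mod κ (toℤ-modFₙ a)))))

  glide-identity : ∀ x → glide 0ℤ 0ℤ 0ℤ x ≡ x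
  glide-identity = points-elim λ a b →
    trans (glide-⟪⟫ 0ℤ 0ℤ 0ℤ a b) (cong₂ ⟪_,_⟫ (solve (a ∷ [])) (solve (a ∷ b ∷ [])))

  glide-zero : ∀ s κ c → s ≡ 0ℤ → κ ≡ 0ℤ → c ≡ 0ℤ → ∀ x → glide s κ c x ≡ x
  glide-zero _ _ _ refl refl refl = glide-identity

  glide-glide : ∀ s κ c s′ κ′ c′ x →
                glide s′ κ′ c′ (glide s κ c x) ≡ glide (s + s′) (κ + κ′) (c + c′ + κ′ · s) x
  glide-glide s κ c s′ κ′ c′ = points-elim λ a b → begin
    glide s′ κ′ c′ (glide s κ c ⟪ a , b ⟫)                   ≡⟨ cong (glide s′ κ′ c′) (glide-⟪⟫ s κ c a b) ⟩
    glide s′ κ′ c′ ⟪ a + s , b + κ · a + c ⟫                 ≡⟨ glide-⟪⟫ s′ κ′ c′ _ _ ⟩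
    ⟪ a + s + s′ , b + κ · a + c + κ′ · (a + s) + c′ ⟫       ≡⟨ cong₂ ⟪_,_⟫ (solve (a ∷ s ∷ s′ ∷ []))
                                                                   (solve (a ∷ b ∷ s ∷ κ ∷ c ∷ κ′ ∷ c′ ∷ [])) ⟩
    ⟪ a + (s + s′) , b + (κ + κ′) · a + (c + c′ + κ′ · s) ⟫  ≡⟨ glide-⟪⟫ (s + s′) (κ + κ′) (c + c′ + κ′ · s) a b ⟨
    glide (s + s′) (κ + κ′) (c + c′ + κ′ · s) ⟪ a , b ⟫      ∎
    where open ≡-Reasoning

  turn-turn : ∀ a κ c a′ κ′ c′ x →
              turn a′ κ′ c′ (turn a κ c x) ≡ glide (a′ - a) (- (+ 4 · a) - κ - κ′) (+ 2 · (a · a) + κ′ · a + c′ - c) x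
  turn-turn a κ c a′ κ′ c′ = points-elim λ p q → begin
    turn a′ κ′ c′ (turn a κ c ⟪ p , q ⟫)
      ≡⟨ cong (turn a′ κ′ c′) (turn-⟪⟫ a κ c p q) ⟩
    turn a′ κ′ c′ ⟪ a - p , - q + + 2 · (p · p) + κ · p + c ⟫
      ≡⟨ turn-⟪⟫ a′ κ′ c′ _ _ ⟩
    ⟪ a′ - (a - p) , - (- q + + 2 · (p · p) + κ · p + c) + + 2 · ((a - p) · (a - p)) + κ′ · (a - p) + c′ ⟫
      ≡⟨ cong₂ ⟪_,_⟫ (solve (p ∷ a ∷ a′ ∷ [])) (solve (p ∷ q ∷ a ∷ κ ∷ c ∷ κ′ ∷ c′ ∷ [])) ⟩
    ⟪ p + (a′ - a) , q + (- (+ 4 · a) - κ - κ′) · p + (+ 2 · (a · a) + κ′ · a + c′ - c) ⟫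
      ≡⟨ glide-⟪⟫ (a′ - a) (- (+ 4 · a) - κ - κ′) (+ 2 · (a · a) + κ′ · a + c′ - c) p q ⟨
    glide (a′ - a) (- (+ 4 · a) - κ - κ′) (+ 2 · (a · a) + κ′ · a + c′ - c) ⟪ p , q ⟫ ∎
    where open ≡-Reasoning

  turn-glide : ∀ a κ c s κ′ c′ x →
               turn a κ c (glide s κ′ c′ x) ≡ turn (a - s) (+ 4 · s + κ - κ′) (+ 2 · (s · s) + κ · s + c - c′) x
  turn-glide a κ c s κ′ c′ = points-elim λ p q → begin
    turn a κ c (glide s κ′ c′ ⟪ p , q ⟫)
      ≡⟨ cong (turn a κ c) (glide-⟪⟫ s κ′ c′ p q) ⟩
    turn a κ c ⟪ p + s , q + κ′ · p + c′ ⟫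
      ≡⟨ turn-⟪⟫ a κ c _ _ ⟩
    ⟪ a - (p + s) , - (q + κ′ · p + c′) + + 2 · ((p + s) · (p + s)) + κ · (p + s) + c ⟫
      ≡⟨ cong₂ ⟪_,_⟫ (solve (p ∷ a ∷ s ∷ [])) (solve (p ∷ q ∷ a ∷ κ ∷ c ∷ s ∷ κ′ ∷ c′ ∷ [])) ⟩
    ⟪ (a - s) - p , - q + + 2 · (p · p) + (+ 4 · s + κ - κ′) · p + (+ 2 · (s · s) + κ · s + c - c′) ⟫
      ≡⟨ turn-⟪⟫ (a - s) (+ 4 · s + κ - κ′) (+ 2 · (s · s) + κ · s + c - c′) p q ⟨
    turn (a - s) (+ 4 · s + κ - κ′) (+ 2 · (s · s) + κ · s + c - c′) ⟪ p , q ⟫ ∎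
    where open ≡-Reasoning

  flip-flip : ∀ a κ c a′ κ′ c′ x → flip a′ κ′ c′ (flip a κ c x) ≡ glide (a′ - a) (κ - κ′) (c + κ′ · a + c′) x
  flip-flip a κ c a′ κ′ c′ = points-elim λ p q → begin
    flip a′ κ′ c′ (flip a κ c ⟪ p , q ⟫)                        ≡⟨ cong (flip a′ κ′ c′) (flip-⟪⟫ a κ c p q) ⟩
    flip a′ κ′ c′ ⟪ a - p , q + κ · p + c ⟫                     ≡⟨ flip-⟪⟫ a′ κ′ c′ _ _ ⟩
    ⟪ a′ - (a - p) , q + κ · p + c + κ′ · (a - p) + c′ ⟫        ≡⟨ cong₂ ⟪_,_⟫ (solve (p ∷ a ∷ a′ ∷ []))
                                                                      (solve (p ∷ q ∷ a ∷ κ ∷ c ∷ κ′ ∷ c′ ∷ [])) ⟩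
    ⟪ p + (a′ - a) , q + (κ - κ′) · p + (c + κ′ · a + c′) ⟫     ≡⟨ glide-⟪⟫ (a′ - a) (κ - κ′) (c + κ′ · a + c′) p q ⟨
    glide (a′ - a) (κ - κ′) (c + κ′ · a + c′) ⟪ p , q ⟫         ∎
    where open ≡-Reasoning

  η₁ᵐ η₂ᵐ : V → V
  η₁ᵐ = glide 1ℤ 0ℤ 0ℤ
  η₂ᵐ = turn 0ℤ (- + 2) 0ℤ

  η₁ᵐ⨾η₂ᵐ : ∀ x → (η₁ᵐ ⨾ η₂ᵐ) x ≡ turn -1ℤ (+ 2) 0ℤ x
  η₁ᵐ⨾η₂ᵐ = turn-glide 0ℤ (- + 2) 0ℤ 1ℤ 0ℤ 0ℤ

module Model (n m : ℕ) .{{_ : NonZero n}} .{{_ : NonZero m}} (m∣n : m ℕ.∣ n) (2<n : 2 ℕ.< n)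
             (¼ : ℤ) (4·¼≡1 : + 4 · ¼ ≡ 1ℤ mod m) where
  open Lex n m
  open Maps n m
  open IntegerPoints n m m∣n

  2≢0-mod-n : ¬ (+ 2 ≡ 0ℤ mod n)
  2≢0-mod-n eq with <-≡-mod⇒≡ {n} {2} {0} 2<n (ℕ.>-nonZero⁻¹ n) eq
  ... | ()

  a+1≢a-1 : ∀ a → ¬ (a + 1ℤ ≡ a - 1ℤ mod n)
  a+1≢a-1 a eq = 2≢0-mod-n (begin
    + 2                         ≡⟨ solve (a ∷ []) ⟩
    (a + 1ℤ) - (a - 1ℤ)         ≈⟨ +-congʳ-mod (- (a - 1ℤ)) eq ⟩
    (a - 1ℤ) - (a - 1ℤ)         ≡⟨ ℤ.+-inverseʳ (a - 1ℤ) ⟩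
    0ℤ                          ∎)
    where open ≡-mod-Reasoning n

  rotᵐ : V → V → V
  rotᵐ (i , y) (i′ , k) with i′ Fin.≟ r i
  ... | yes _ = ⟪ toℤ i - 1ℤ , + 2 · toℤ y - toℤ k ⟫
  ... | no  _ = ⟪ toℤ i + 1ℤ , + 2 · toℤ y - toℤ k + + 4 ⟫

  rotᵐ-up : ∀ {i i′} y k → i′ ≡ r i → rotᵐ (i , y) (i′ , k) ≡ ⟪ toℤ i - 1ℤ , + 2 · toℤ y - toℤ k ⟫
  rotᵐ-up {i} {i′} y k i′≡ri with i′ Fin.≟ r i
  ... | yes _     = refl
  ... | no i′≢ri = ⊥-elim (i′≢ri i′≡ri)

  rotᵐ-down : ∀ {i i′} y k → i′ ≢ r i → rotᵐ (i , y) (i′ , k) ≡ ⟪ toℤ i + 1ℤ , + 2 · toℤ y - toℤ k + + 4 ⟫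
  rotᵐ-down {i} {i′} y k i′≢ri with i′ Fin.≟ r i
  ... | yes i′≡ri = ⊥-elim (i′≢ri i′≡ri)
  ... | no _      = refl

  below≢above : ∀ {a a′} → a′ ≡ a - 1ℤ mod n → modF n a′ ≢ r (modF n a)
  below≢above {a} {a′} a′≡a-1 a′≡ra = a+1≢a-1 a (begin
    a + 1ℤ                 ≈⟨ ≡-mod-sym (toℤ-modF (a + 1ℤ)) ⟩
    toℤ (modF n (a + 1ℤ))  ≡⟨ cong toℤ (r-modF a) ⟨
    toℤ (r (modF n a))     ≡⟨ cong toℤ a′≡ra ⟨
    toℤ (modF n a′)        ≈⟨ toℤ-modF a′ ⟩
    a′                     ≈⟨ a′≡a-1 ⟩
    a - 1ℤ                 ∎)
    where open ≡-mod-Reasoning n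

  rotᵐ-above : ∀ {a a′} b c → a′ ≡ a + 1ℤ mod n → rotᵐ ⟪ a , b ⟫ ⟪ a′ , c ⟫ ≡ ⟪ a - 1ℤ , + 2 · b - c ⟫
  rotᵐ-above {a} {a′} b c a′≡a+1 = begin
    rotᵐ ⟪ a , b ⟫ ⟪ a′ , c ⟫                            ≡⟨ cong₂ rotᵐ (⟪⟫-def a b) (⟪⟫-def a′ c) ⟩
    rotᵐ (modF n a , modF m b) (modF n a′ , modF m c)    ≡⟨ rotᵐ-up _ _ (trans (modF-cong a′≡a+1) (sym (r-modF a))) ⟩
    ⟪ toℤ (modF n a) - 1ℤ , + 2 · toℤ (modF m b) - toℤ (modF m c) ⟫
      ≡⟨ ⟪⟫-cong (+-congʳ-mod -1ℤ (toℤ-modF a))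
                 (+-cong-mod (·-congˡ-mod (+ 2) (toℤ-modF b)) (-‿cong-mod (toℤ-modF c))) ⟩
    ⟪ a - 1ℤ , + 2 · b - c ⟫                               ∎
    where open ≡-Reasoning

  rotᵐ-below : ∀ {a a′} b c → a′ ≡ a - 1ℤ mod n → rotᵐ ⟪ a , b ⟫ ⟪ a′ , c ⟫ ≡ ⟪ a + 1ℤ , + 2 · b - c + + 4 ⟫
  rotᵐ-below {a} {a′} b c a′≡a-1 = begin
    rotᵐ ⟪ a , b ⟫ ⟪ a′ , c ⟫                            ≡⟨ cong₂ rotᵐ (⟪⟫-def a b) (⟪⟫-def a′ c) ⟩
    rotᵐ (modF n a , modF m b) (modF n a′ , modF m c)    ≡⟨ rotᵐ-down _ _ (below≢above {a} a′≡a-1) ⟩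
    ⟪ toℤ (modF n a) + 1ℤ , + 2 · toℤ (modF m b) - toℤ (modF m c) + + 4 ⟫
      ≡⟨ ⟪⟫-cong (+-congʳ-mod 1ℤ (toℤ-modF a))
                 (+-congʳ-mod (+ 4) (+-cong-mod (·-congˡ-mod (+ 2) (toℤ-modF b)) (-‿cong-mod (toℤ-modF c)))) ⟩
    ⟪ a + 1ℤ , + 2 · b - c + + 4 ⟫                         ∎
    where open ≡-Reasoning

  private
    ≡-mod-cancel : ∀ {x y} d → d - x ≡ d - y mod m → x ≡ y mod m
    ≡-mod-cancel {x} {y} d eq = begin
      x              ≡⟨ solve (d ∷ x ∷ []) ⟩
      d - (d - x)    ≈⟨ +-congˡ-mod d (-‿cong-mod eq) ⟩
      d - (d - y)    ≡⟨ solve (d ∷ y ∷ []) ⟩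
      y              ∎
      where open ≡-mod-Reasoning m

  rotᵐ-injective : ∀ a b {v w} → Neighbour a v → Neighbour a w → rotᵐ ⟪ a , b ⟫ v ≡ rotᵐ ⟪ a , b ⟫ w → v ≡ w
  rotᵐ-injective a b (above c) (above c′) eq = ⟪⟫-cong ≡-mod-refl (≡-mod-cancel (+ 2 · b) (proj₂ (⟪⟫-injective
    (trans (sym (rotᵐ-above b c ≡-mod-refl)) (trans eq (rotᵐ-above b c′ ≡-mod-refl))))))
  rotᵐ-injective a b (below c) (below c′) eq =
    ⟪⟫-cong ≡-mod-refl (≡-mod-cancel (+ 2 · b) (+-cancelʳ-mod (+ 4) (proj₂ (⟪⟫-injective
      (trans (sym (rotᵐ-below b c ≡-mod-refl)) (trans eq (rotᵐ-below b c′ ≡-mod-refl)))))))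
  rotᵐ-injective a b (above c) (below c′) eq = ⊥-elim (a+1≢a-1 a (≡-mod-sym (proj₁ (⟪⟫-injective
    (trans (sym (rotᵐ-above b c ≡-mod-refl)) (trans eq (rotᵐ-below b c′ ≡-mod-refl)))))))
  rotᵐ-injective a b (below c) (above c′) eq = ⊥-elim (a+1≢a-1 a (proj₁ (⟪⟫-injective
    (trans (sym (rotᵐ-below b c ≡-mod-refl)) (trans eq (rotᵐ-above b c′ ≡-mod-refl))))))

  orbit : ∀ a b c e → iter (rotᵐ ⟪ a , b ⟫) (e ℕ.+ e) ⟪ a + 1ℤ , c ⟫ ≡ ⟪ a + 1ℤ , c + + 4 · + e ⟫
                    × iter (rotᵐ ⟪ a , b ⟫) (suc (e ℕ.+ e)) ⟪ a + 1ℤ , c ⟫ ≡ ⟪ a - 1ℤ , + 2 · b - c - + 4 · + e ⟫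
  orbit a b c zero = cong ⟪ a + 1ℤ ,_⟫ (sym (ℤ.+-identityʳ c))
                   , trans (rotᵐ-above b c ≡-mod-refl) (cong ⟪ a - 1ℤ ,_⟫ (sym (ℤ.+-identityʳ (+ 2 · b - c))))
  orbit a b c (suc e) = even , odd
    where
    open ≡-Reasoning
    even : iter (rotᵐ ⟪ a , b ⟫) (suc e ℕ.+ suc e) ⟪ a + 1ℤ , c ⟫ ≡ ⟪ a + 1ℤ , c + + 4 · (1ℤ + + e) ⟫
    even = begin
      iter (rotᵐ ⟪ a , b ⟫) (suc e ℕ.+ suc e) ⟪ a + 1ℤ , c ⟫
        ≡⟨ cong (λ k → iter (rotᵐ ⟪ a , b ⟫) (suc k) ⟪ a + 1ℤ , c ⟫) (ℕ.+-suc e e) ⟩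
      rotᵐ ⟪ a , b ⟫ (iter (rotᵐ ⟪ a , b ⟫) (suc (e ℕ.+ e)) ⟪ a + 1ℤ , c ⟫)
        ≡⟨ cong (rotᵐ ⟪ a , b ⟫) (proj₂ (orbit a b c e)) ⟩
      rotᵐ ⟪ a , b ⟫ ⟪ a - 1ℤ , + 2 · b - c - + 4 · + e ⟫
        ≡⟨ rotᵐ-below b _ ≡-mod-refl ⟩
      ⟪ a + 1ℤ , + 2 · b - (+ 2 · b - c - + 4 · + e) + + 4 ⟫
        ≡⟨ cong ⟪ a + 1ℤ ,_⟫ (lemma b c (+ e)) ⟩
      ⟪ a + 1ℤ , c + + 4 · (1ℤ + + e) ⟫ ∎
      where
      lemma : ∀ b c e → + 2 · b - (+ 2 · b - c - + 4 · e) + + 4 ≡ c + + 4 · (1ℤ + e)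
      lemma b c e = solve (b ∷ c ∷ e ∷ [])
    odd : iter (rotᵐ ⟪ a , b ⟫) (suc (suc e ℕ.+ suc e)) ⟪ a + 1ℤ , c ⟫ ≡ ⟪ a - 1ℤ , + 2 · b - c - + 4 · (1ℤ + + e) ⟫
    odd = begin
      rotᵐ ⟪ a , b ⟫ (iter (rotᵐ ⟪ a , b ⟫) (suc e ℕ.+ suc e) ⟪ a + 1ℤ , c ⟫)
        ≡⟨ cong (rotᵐ ⟪ a , b ⟫) even ⟩
      rotᵐ ⟪ a , b ⟫ ⟪ a + 1ℤ , c + + 4 · (1ℤ + + e) ⟫
        ≡⟨ rotᵐ-above b _ ≡-mod-refl ⟩
      ⟪ a - 1ℤ , + 2 · b - (c + + 4 · (1ℤ + + e)) ⟫
        ≡⟨ cong ⟪ a - 1ℤ ,_⟫ (lemma b c (+ e)) ⟩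
      ⟪ a - 1ℤ , + 2 · b - c - + 4 · (1ℤ + + e) ⟫ ∎
      where
      lemma : ∀ b c e → + 2 · b - (c + + 4 · (1ℤ + e)) ≡ + 2 · b - c - + 4 · (1ℤ + e)
      lemma b c e = solve (b ∷ c ∷ e ∷ [])

  quarter : ℤ → ℕ
  quarter d = toℕ (modF m (d · ¼))

  4·quarter : ∀ d → + 4 · + quarter d ≡ d mod m
  4·quarter d = begin
    + 4 · + quarter d           ≡⟨ cong (+ 4 ·_) (toℤ-def _) ⟨
    + 4 · toℤ (modF m (d · ¼))  ≈⟨ ·-congˡ-mod (+ 4) (toℤ-modF (d · ¼)) ⟩
    + 4 · (d · ¼)               ≡⟨ solve (d ∷ ¼ ∷ []) ⟩
    d · (+ 4 · ¼)               ≈⟨ ·-congˡ-mod d 4·¼≡1 ⟩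
    d · 1ℤ                      ≡⟨ ℤ.*-identityʳ d ⟩
    d                           ∎
    where open ≡-mod-Reasoning m

  orbit-from-above : ∀ a b c {w} → Neighbour a w → ∃ λ k → iter (rotᵐ ⟪ a , b ⟫) k ⟪ a + 1ℤ , c ⟫ ≡ w
  orbit-from-above a b c (above c′) = e ℕ.+ e , trans (proj₁ (orbit a b c e)) (⟪⟫-cong ≡-mod-refl (begin
    c + + 4 · + e    ≈⟨ +-congˡ-mod c (4·quarter (c′ - c)) ⟩
    c + (c′ - c)     ≡⟨ solve (c ∷ c′ ∷ []) ⟩
    c′               ∎))
    where
    open ≡-mod-Reasoning m
    e = quarter (c′ - c)
  orbit-from-above a b c (below c′) = suc (e ℕ.+ e) , trans (proj₂ (orbit a b c e)) (⟪⟫-cong ≡-mod-refl (begin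
    + 2 · b - c - + 4 · + e            ≈⟨ +-congˡ-mod (+ 2 · b - c) (-‿cong-mod (4·quarter (+ 2 · b - c - c′))) ⟩
    + 2 · b - c - (+ 2 · b - c - c′)   ≡⟨ solve (b ∷ c ∷ c′ ∷ []) ⟩
    c′                                 ∎))
    where
    open ≡-mod-Reasoning m
    e = quarter (+ 2 · b - c - c′)

  rotᵐ-cyclic : ∀ a b {v w} → Neighbour a v → Neighbour a w → ∃ λ k → iter (rotᵐ ⟪ a , b ⟫) k v ≡ w
  rotᵐ-cyclic a b (above c) w = orbit-from-above a b c w
  rotᵐ-cyclic a b (below c) w with orbit-from-above a b (+ 2 · b - c + + 4) w
  ... | k , p = suc k , trans (iter-suc (rotᵐ ⟪ a , b ⟫) k _)
                               (trans (cong (iter (rotᵐ ⟪ a , b ⟫) k) (rotᵐ-below b c ≡-mod-refl)) p)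

  model : RotSys
  model = record
    { rot     = rotᵐ
    ; rot-adj = adjacent-elim
        (λ a b c → subst (Adj ⟪ a , b ⟫) (sym (rotᵐ-above b c ≡-mod-refl)) (adj-below ≡-mod-refl))
        (λ a b c → subst (Adj ⟪ a , b ⟫) (sym (rotᵐ-below b c ≡-mod-refl)) (adj-above ≡-mod-refl))
    ; rot-inj = points-elim λ a b v w av aw → rotᵐ-injective a b (neighbour {a} {b} av) (neighbour {a} {b} aw)
    ; rot-cyc = points-elim λ a b v w av aw → rotᵐ-cyclic a b (neighbour {a} {b} av) (neighbour {a} {b} aw)
    }

  glide-rot : ∀ s κ c u v → Adj u v → glide s κ c (rotᵐ u v) ≡ rotᵐ (glide s κ c u) (glide s κ c v)
  glide-rot s κ c = adjacent-elim up down
    where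
    open ≡-Reasoning
    g = glide s κ c
    up : ∀ a b d → g (rotᵐ ⟪ a , b ⟫ ⟪ a + 1ℤ , d ⟫) ≡ rotᵐ (g ⟪ a , b ⟫) (g ⟪ a + 1ℤ , d ⟫)
    up a b d = begin
      g (rotᵐ ⟪ a , b ⟫ ⟪ a + 1ℤ , d ⟫)                                  ≡⟨ cong g (rotᵐ-above b d ≡-mod-refl) ⟩
      g ⟪ a - 1ℤ , + 2 · b - d ⟫                                          ≡⟨ glide-⟪⟫ s κ c _ _ ⟩
      ⟪ a - 1ℤ + s , + 2 · b - d + κ · (a - 1ℤ) + c ⟫                     ≡⟨ cong₂ ⟪_,_⟫ (solve (a ∷ s ∷ []))
                                                                              (solve (a ∷ b ∷ d ∷ κ ∷ c ∷ [])) ⟩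
      ⟪ a + s - 1ℤ , + 2 · (b + κ · a + c) - (d + κ · (a + 1ℤ) + c) ⟫
        ≡⟨ rotᵐ-above _ _ (≡-mod-reflexive (solve (a ∷ s ∷ []))) ⟨
      rotᵐ ⟪ a + s , b + κ · a + c ⟫ ⟪ a + 1ℤ + s , d + κ · (a + 1ℤ) + c ⟫
        ≡⟨ cong₂ rotᵐ (glide-⟪⟫ s κ c a b) (glide-⟪⟫ s κ c (a + 1ℤ) d) ⟨
      rotᵐ (g ⟪ a , b ⟫) (g ⟪ a + 1ℤ , d ⟫)                                ∎
    down : ∀ a b d → g (rotᵐ ⟪ a , b ⟫ ⟪ a - 1ℤ , d ⟫) ≡ rotᵐ (g ⟪ a , b ⟫) (g ⟪ a - 1ℤ , d ⟫)
    down a b d = begin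
      g (rotᵐ ⟪ a , b ⟫ ⟪ a - 1ℤ , d ⟫)                                  ≡⟨ cong g (rotᵐ-below b d ≡-mod-refl) ⟩
      g ⟪ a + 1ℤ , + 2 · b - d + + 4 ⟫                                    ≡⟨ glide-⟪⟫ s κ c _ _ ⟩
      ⟪ a + 1ℤ + s , + 2 · b - d + + 4 + κ · (a + 1ℤ) + c ⟫               ≡⟨ cong₂ ⟪_,_⟫ (solve (a ∷ s ∷ []))
                                                                              (solve (a ∷ b ∷ d ∷ κ ∷ c ∷ [])) ⟩
      ⟪ a + s + 1ℤ , + 2 · (b + κ · a + c) - (d + κ · (a - 1ℤ) + c) + + 4 ⟫
        ≡⟨ rotᵐ-below _ _ (≡-mod-reflexive (solve (a ∷ s ∷ []))) ⟨
      rotᵐ ⟪ a + s , b + κ · a + c ⟫ ⟪ a - 1ℤ + s , d + κ · (a - 1ℤ) + c ⟫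
        ≡⟨ cong₂ rotᵐ (glide-⟪⟫ s κ c a b) (glide-⟪⟫ s κ c (a - 1ℤ) d) ⟨
      rotᵐ (g ⟪ a , b ⟫) (g ⟪ a - 1ℤ , d ⟫)                                ∎

  turn-rot : ∀ a₀ κ c u v → Adj u v → turn a₀ κ c (rotᵐ u v) ≡ rotᵐ (turn a₀ κ c u) (turn a₀ κ c v)
  turn-rot a₀ κ c = adjacent-elim up down
    where
    open ≡-Reasoning
    g = turn a₀ κ c
    up : ∀ a b d → g (rotᵐ ⟪ a , b ⟫ ⟪ a + 1ℤ , d ⟫) ≡ rotᵐ (g ⟪ a , b ⟫) (g ⟪ a + 1ℤ , d ⟫)
    up a b d = begin
      g (rotᵐ ⟪ a , b ⟫ ⟪ a + 1ℤ , d ⟫)                    ≡⟨ cong g (rotᵐ-above b d ≡-mod-refl) ⟩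
      g ⟪ a - 1ℤ , + 2 · b - d ⟫                            ≡⟨ turn-⟪⟫ a₀ κ c _ _ ⟩
      ⟪ a₀ - (a - 1ℤ) , - (+ 2 · b - d) + + 2 · ((a - 1ℤ) · (a - 1ℤ)) + κ · (a - 1ℤ) + c ⟫
        ≡⟨ cong₂ ⟪_,_⟫ (solve (a ∷ a₀ ∷ [])) (solve (a ∷ b ∷ d ∷ κ ∷ c ∷ [])) ⟩
      ⟪ a₀ - a + 1ℤ , + 2 · (- b + + 2 · (a · a) + κ · a + c)
                      - (- d + + 2 · ((a + 1ℤ) · (a + 1ℤ)) + κ · (a + 1ℤ) + c) + + 4 ⟫
        ≡⟨ rotᵐ-below _ _ (≡-mod-reflexive (solve (a ∷ a₀ ∷ []))) ⟨
      rotᵐ ⟪ a₀ - a , - b + + 2 · (a · a) + κ · a + c ⟫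
           ⟪ a₀ - (a + 1ℤ) , - d + + 2 · ((a + 1ℤ) · (a + 1ℤ)) + κ · (a + 1ℤ) + c ⟫
        ≡⟨ cong₂ rotᵐ (turn-⟪⟫ a₀ κ c a b) (turn-⟪⟫ a₀ κ c (a + 1ℤ) d) ⟨
      rotᵐ (g ⟪ a , b ⟫) (g ⟪ a + 1ℤ , d ⟫)                 ∎
    down : ∀ a b d → g (rotᵐ ⟪ a , b ⟫ ⟪ a - 1ℤ , d ⟫) ≡ rotᵐ (g ⟪ a , b ⟫) (g ⟪ a - 1ℤ , d ⟫)
    down a b d = begin
      g (rotᵐ ⟪ a , b ⟫ ⟪ a - 1ℤ , d ⟫)                    ≡⟨ cong g (rotᵐ-below b d ≡-mod-refl) ⟩
      g ⟪ a + 1ℤ , + 2 · b - d + + 4 ⟫                      ≡⟨ turn-⟪⟫ a₀ κ c _ _ ⟩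
      ⟪ a₀ - (a + 1ℤ) , - (+ 2 · b - d + + 4) + + 2 · ((a + 1ℤ) · (a + 1ℤ)) + κ · (a + 1ℤ) + c ⟫
        ≡⟨ cong₂ ⟪_,_⟫ (solve (a ∷ a₀ ∷ [])) (solve (a ∷ b ∷ d ∷ κ ∷ c ∷ [])) ⟩
      ⟪ a₀ - a - 1ℤ , + 2 · (- b + + 2 · (a · a) + κ · a + c)
                      - (- d + + 2 · ((a - 1ℤ) · (a - 1ℤ)) + κ · (a - 1ℤ) + c) ⟫
        ≡⟨ rotᵐ-above _ _ (≡-mod-reflexive (solve (a ∷ a₀ ∷ []))) ⟨
      rotᵐ ⟪ a₀ - a , - b + + 2 · (a · a) + κ · a + c ⟫
           ⟪ a₀ - (a - 1ℤ) , - d + + 2 · ((a - 1ℤ) · (a - 1ℤ)) + κ · (a - 1ℤ) + c ⟫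
        ≡⟨ cong₂ rotᵐ (turn-⟪⟫ a₀ κ c a b) (turn-⟪⟫ a₀ κ c (a - 1ℤ) d) ⟨
      rotᵐ (g ⟪ a , b ⟫) (g ⟪ a - 1ℤ , d ⟫)                 ∎

  flip-rot : ∀ a₀ κ c u v → Adj u v → rotᵐ (flip a₀ κ c u) (flip a₀ κ c (rotᵐ u v)) ≡ flip a₀ κ c v
  flip-rot a₀ κ c = adjacent-elim up down
    where
    open ≡-Reasoning
    g = flip a₀ κ c
    up : ∀ a b d → rotᵐ (g ⟪ a , b ⟫) (g (rotᵐ ⟪ a , b ⟫ ⟪ a + 1ℤ , d ⟫)) ≡ g ⟪ a + 1ℤ , d ⟫
    up a b d = begin
      rotᵐ (g ⟪ a , b ⟫) (g (rotᵐ ⟪ a , b ⟫ ⟪ a + 1ℤ , d ⟫))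
        ≡⟨ cong₂ rotᵐ (flip-⟪⟫ a₀ κ c a b) (trans (cong g (rotᵐ-above b d ≡-mod-refl)) (flip-⟪⟫ a₀ κ c _ _)) ⟩
      rotᵐ ⟪ a₀ - a , b + κ · a + c ⟫ ⟪ a₀ - (a - 1ℤ) , + 2 · b - d + κ · (a - 1ℤ) + c ⟫
        ≡⟨ rotᵐ-above _ _ (≡-mod-reflexive (solve (a ∷ a₀ ∷ []))) ⟩
      ⟪ a₀ - a - 1ℤ , + 2 · (b + κ · a + c) - (+ 2 · b - d + κ · (a - 1ℤ) + c) ⟫
        ≡⟨ cong₂ ⟪_,_⟫ (solve (a ∷ a₀ ∷ [])) (solve (a ∷ b ∷ d ∷ κ ∷ c ∷ [])) ⟩
      ⟪ a₀ - (a + 1ℤ) , d + κ · (a + 1ℤ) + c ⟫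
        ≡⟨ flip-⟪⟫ a₀ κ c (a + 1ℤ) d ⟨
      g ⟪ a + 1ℤ , d ⟫ ∎
    down : ∀ a b d → rotᵐ (g ⟪ a , b ⟫) (g (rotᵐ ⟪ a , b ⟫ ⟪ a - 1ℤ , d ⟫)) ≡ g ⟪ a - 1ℤ , d ⟫
    down a b d = begin
      rotᵐ (g ⟪ a , b ⟫) (g (rotᵐ ⟪ a , b ⟫ ⟪ a - 1ℤ , d ⟫))
        ≡⟨ cong₂ rotᵐ (flip-⟪⟫ a₀ κ c a b) (trans (cong g (rotᵐ-below b d ≡-mod-refl)) (flip-⟪⟫ a₀ κ c _ _)) ⟩
      rotᵐ ⟪ a₀ - a , b + κ · a + c ⟫ ⟪ a₀ - (a + 1ℤ) , + 2 · b - d + + 4 + κ · (a + 1ℤ) + c ⟫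
        ≡⟨ rotᵐ-below _ _ (≡-mod-reflexive (solve (a ∷ a₀ ∷ []))) ⟩
      ⟪ a₀ - a + 1ℤ , + 2 · (b + κ · a + c) - (+ 2 · b - d + + 4 + κ · (a + 1ℤ) + c) + + 4 ⟫
        ≡⟨ cong₂ ⟪_,_⟫ (solve (a ∷ a₀ ∷ [])) (solve (a ∷ b ∷ d ∷ κ ∷ c ∷ [])) ⟩
      ⟪ a₀ - (a - 1ℤ) , d + κ · (a - 1ℤ) + c ⟫
        ≡⟨ flip-⟪⟫ a₀ κ c (a - 1ℤ) d ⟨
      g ⟪ a - 1ℤ , d ⟫ ∎

  glide-aut : ∀ s κ c → IsAut⁺ model (glide s κ c)
  glide-aut s κ c =
    graphAut model (glide s κ c) (glide (- s) (- κ) (κ · s - c)) inverse-left inverse-right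
      (translation-adj (glide s κ c) s shape) (translation-adj (glide (- s) (- κ) (κ · s - c)) (- s) shape⁻¹) , glide-rot s κ c
    where
    shape : ∀ a b → ∃ λ (y : ℤ) → glide s κ c ⟪ a , b ⟫ ≡ ⟪ a + s , y ⟫
    shape a b = _ , glide-⟪⟫ s κ c a b
    shape⁻¹ : ∀ a b → ∃ λ (y : ℤ) → glide (- s) (- κ) (κ · s - c) ⟪ a , b ⟫ ≡ ⟪ a + - s , y ⟫
    shape⁻¹ a b = _ , glide-⟪⟫ (- s) (- κ) (κ · s - c) a b
    inverse-left : ∀ x → glide (- s) (- κ) (κ · s - c) (glide s κ c x) ≡ x
    inverse-left x = trans (glide-glide s κ c (- s) (- κ) (κ · s - c) x)
      (glide-zero _ _ (c + (κ · s - c) + - κ · s) (ℤ.+-inverseʳ s) (ℤ.+-inverseʳ κ) (solve (s ∷ κ ∷ c ∷ [])) x)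
    inverse-right : ∀ x → glide s κ c (glide (- s) (- κ) (κ · s - c) x) ≡ x
    inverse-right x = trans (glide-glide (- s) (- κ) (κ · s - c) s κ c x)
      (glide-zero _ _ (κ · s - c + c + κ · - s) (ℤ.+-inverseˡ s) (ℤ.+-inverseˡ κ) (solve (s ∷ κ ∷ c ∷ [])) x)

  turn-aut : ∀ a κ c → IsAut⁺ model (turn a κ c)
  turn-aut a κ c =
    graphAut model (turn a κ c) (turn a κ′ c′) inverse-left inverse-right
      (reflection-adj (turn a κ c) a (λ p q → _ , turn-⟪⟫ a κ c p q))
      (reflection-adj (turn a κ′ c′) a (λ p q → _ , turn-⟪⟫ a κ′ c′ p q))
    , turn-rot a κ c
    where
    κ′ = - κ - + 4 · a
    c′ = c - + 2 · (a · a) - κ′ · a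
    inverse-left : ∀ x → turn a κ′ c′ (turn a κ c x) ≡ x
    inverse-left x = trans (turn-turn a κ c a κ′ c′ x)
      (glide-zero (a - a) (- (+ 4 · a) - κ - (- κ - + 4 · a))
                  (+ 2 · (a · a) + (- κ - + 4 · a) · a + (c - + 2 · (a · a) - (- κ - + 4 · a) · a) - c)
                  (ℤ.+-inverseʳ a) (solve (a ∷ κ ∷ [])) (solve (a ∷ κ ∷ c ∷ [])) x)
    inverse-right : ∀ x → turn a κ c (turn a κ′ c′ x) ≡ x
    inverse-right x = trans (turn-turn a κ′ c′ a κ c x)
      (glide-zero (a - a) (- (+ 4 · a) - (- κ - + 4 · a) - κ)
                  (+ 2 · (a · a) + κ · a + c - (c - + 2 · (a · a) - (- κ - + 4 · a) · a))
                  (ℤ.+-inverseʳ a) (solve (a ∷ κ ∷ [])) (solve (a ∷ κ ∷ c ∷ [])) x)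

  flip-aut : ∀ a κ c → IsAut⁻ model (flip a κ c)
  flip-aut a κ c =
    graphAut model (flip a κ c) (flip a κ c′) inverse-left inverse-right
      (reflection-adj (flip a κ c) a (λ p q → _ , flip-⟪⟫ a κ c p q))
      (reflection-adj (flip a κ c′) a (λ p q → _ , flip-⟪⟫ a κ c′ p q))
    , flip-rot a κ c
    where
    c′ = - c - κ · a
    inverse-left : ∀ x → flip a κ c′ (flip a κ c x) ≡ x
    inverse-left x = trans (flip-flip a κ c a κ c′ x)
      (glide-zero (a - a) (κ - κ) (c + κ · a + (- c - κ · a))
                  (ℤ.+-inverseʳ a) (ℤ.+-inverseʳ κ) (solve (a ∷ κ ∷ c ∷ [])) x)
    inverse-right : ∀ x → flip a κ c (flip a κ c′ x) ≡ x
    inverse-right x = trans (flip-flip a κ c′ a κ c x)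
      (glide-zero (a - a) (κ - κ) (- c - κ · a + κ · a + c)
                  (ℤ.+-inverseʳ a) (ℤ.+-inverseʳ κ) (solve (a ∷ κ ∷ c ∷ [])) x)

  record Face (d : Dart) : Set where
    field
      origin direction : ℤ
      height : ℤ → ℤ
      direction² : direction · direction ≡ 1ℤ

    vertex : ℤ → V
    vertex J = ⟪ origin + direction · J , height J ⟫

    field
      boundary : ∀ j → iter (φ model) j d ≡ (vertex (+ j) , vertex (+ suc j))
      periodic : ∀ J → height (+ n + J) ≡ height J mod m
      rotation : V → V
      rotation-aut : IsAut⁺ model rotation
      rotation-step : ∀ J → rotation (vertex J) ≡ vertex (1ℤ + J)

  module FaceProperties {d : Dart} (F : Face d) where
    open Face F

    fv-vertex : ∀ j → fv model d j ≡ vertex (+ j)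
    fv-vertex j = cong proj₁ (boundary j)

    vertex-periodic : ∀ J → vertex (+ n + J) ≡ vertex J
    vertex-periodic J = ⟪⟫-cong layer (periodic J)
      where
      layer : origin + direction · (+ n + J) ≡ origin + direction · J mod n
      layer = begin
        origin + direction · (+ n + J)            ≡⟨ lemma origin direction J (+ n) ⟩
        origin + direction · J + direction · + n
          ≈⟨ +-congˡ-mod (origin + direction · J) (multiple≡0-mod direction) ⟩
        origin + direction · J + 0ℤ               ≡⟨ ℤ.+-identityʳ _ ⟩
        origin + direction · J                    ∎
        where
        open ≡-mod-Reasoning n
        lemma : ∀ o σ J N → o + σ · (N + J) ≡ o + σ · J + σ · N
        lemma o σ J N = solve (o ∷ σ ∷ J ∷ N ∷ [])

    layer-congruence : ∀ {J J′} → vertex J ≡ vertex J′ → J ≡ J′ mod n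
    layer-congruence {J} {J′} eq = begin
      J                                                ≡⟨ unscale J ⟨
      direction · ((origin + direction · J) - origin)
        ≈⟨ ·-congˡ-mod direction (+-congʳ-mod (- origin) (proj₁ (⟪⟫-injective eq))) ⟩
      direction · ((origin + direction · J′) - origin) ≡⟨ unscale J′ ⟩
      J′                                               ∎
      where
      open ≡-mod-Reasoning n
      lemma : ∀ o σ J → σ · ((o + σ · J) - o) ≡ σ · σ · J
      lemma o σ J = solve (o ∷ σ ∷ J ∷ [])
      unscale : ∀ J → direction · ((origin + direction · J) - origin) ≡ J
      unscale J = trans (lemma origin direction J) (trans (cong (_· J) direction²) (ℤ.*-identityˡ J))

    layer-injective : ∀ k l → k ℕ.< n → l ℕ.< n → vertex (+ k) ≡ vertex (+ l) → k ≡ l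
    layer-injective k l k<n l<n eq = <-≡-mod⇒≡ k<n l<n (layer-congruence eq)

    faceLength : FaceLength model d n
    faceLength = closes , minimal
      where
      closes : iter (φ model) n d ≡ d
      closes = begin
        iter (φ model) n d                  ≡⟨ boundary n ⟩
        (vertex (+ n) , vertex (+ suc n))   ≡⟨ cong₂ _,_ (trans (cong vertex (sym (ℤ.+-identityʳ (+ n)))) (vertex-periodic 0ℤ))
                                                         (trans (cong vertex (+-suc n)) (vertex-periodic 1ℤ)) ⟩
        (vertex 0ℤ , vertex 1ℤ)             ≡⟨ boundary 0 ⟨
        d                                   ∎
        where open ≡-Reasoning
      minimal : ∀ k → 0 ℕ.< k → k ℕ.< n → iter (φ model) k d ≢ d
      minimal k 0<k k<n eq = ℕ.<-irrefl (sym k≡0) 0<k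
        where
        k≡0 : k ≡ 0
        k≡0 = layer-injective k 0 k<n (ℕ.>-nonZero⁻¹ n)
                (cong proj₁ (trans (sym (boundary k)) (trans eq (boundary 0))))

    distinct : ∀ k l → k ℕ.< n → l ℕ.< n → fv model d k ≡ fv model d l → k ≡ l
    distinct k l k<n l<n eq = layer-injective k l k<n l<n (trans (sym (fv-vertex k)) (trans eq (fv-vertex l)))

    -- Traversing an edge of the face backwards would move the layer by -direction instead of
    -- direction, forcing 2 ≡ 0 (mod n).
    no-swap : ∀ k → iter (φ model) k d ≢ swap d
    no-swap k eq = 2≢0-mod-n (begin
      + 2                                                       ≡⟨ cong (+ 2 ·_) direction² ⟨
      + 2 · (direction · direction)                             ≡⟨ lemma origin direction (+ k) ⟩
      direction · ((L (1ℤ + + k) - L (+ k)) - (L 0ℤ - L 1ℤ))   ≈⟨ ·-congˡ-mod direction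
                                                                    (+-cong-mod (+-cong-mod e₁ (-‿cong-mod e₀)) ≡-mod-refl) ⟩
      direction · ((L 0ℤ - L 1ℤ) - (L 0ℤ - L 1ℤ))              ≡⟨ cong (direction ·_) (ℤ.+-inverseʳ (L 0ℤ - L 1ℤ)) ⟩
      direction · 0ℤ                                           ≡⟨ ℤ.*-zeroʳ direction ⟩
      0ℤ                                                       ∎)
      where
      open ≡-mod-Reasoning n
      L : ℤ → ℤ
      L J = origin + direction · J
      swapped : (vertex (+ k) , vertex (+ suc k)) ≡ (vertex 1ℤ , vertex 0ℤ)
      swapped = trans (sym (boundary k)) (trans eq (cong swap (boundary 0)))
      e₀ : L (+ k) ≡ L 1ℤ mod n
      e₀ = proj₁ (⟪⟫-injective (cong proj₁ swapped))
      e₁ : L (1ℤ + + k) ≡ L 0ℤ mod n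
      e₁ = proj₁ (⟪⟫-injective (cong proj₂ swapped))
      lemma : ∀ o σ K → + 2 · (σ · σ) ≡ σ · (((o + σ · (1ℤ + K)) - (o + σ · K)) - ((o + σ · 0ℤ) - (o + σ · 1ℤ)))
      lemma o σ K = solve (o ∷ σ ∷ K ∷ [])

    rotation-fv : ∀ j → rotation (fv model d j) ≡ fv model d (suc j)
    rotation-fv j = trans (cong rotation (fv-vertex j)) (trans (rotation-step (+ j)) (sym (fv-vertex (suc j))))

    stabFace : StabFace model rotation d
    stabFace j = suc j , inj₁ (rotation-fv j , rotation-fv (suc j))

    rotation-transitive : ∀ k → iter rotation k (fv model d 0) ≡ fv model d k
    rotation-transitive zero    = refl
    rotation-transitive (suc k) = trans (cong rotation (rotation-transitive k)) (rotation-fv k)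

  descending-face : ∀ a b c → Face (⟪ a , b ⟫ , ⟪ a - 1ℤ , c ⟫)
  descending-face a b c = record
    { origin = a ; direction = -1ℤ ; height = h ; direction² = refl
    ; boundary = λ j → trans (cong (iter (φ model) j) starts) (walk model (X ∘ +_) (λ j → step (+ j)) j)
    ; periodic = periodic
    ; rotation = glide -1ℤ 0ℤ (c - b) ; rotation-aut = glide-aut -1ℤ 0ℤ (c - b)
    ; rotation-step = rotation-step
    }
    where
    h : ℤ → ℤ
    h J = b + J · (c - b)
    X : ℤ → V
    X J = ⟪ a + -1ℤ · J , h J ⟫
    starts : (⟪ a , b ⟫ , ⟪ a - 1ℤ , c ⟫) ≡ (X 0ℤ , X 1ℤ)
    starts = cong₂ _,_ (cong₂ ⟪_,_⟫ (l₀ a) (l₁ b c)) (cong₂ ⟪_,_⟫ (l₂ a) (l₃ b c))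
      where
      l₀ : ∀ a → a ≡ a + -1ℤ · 0ℤ
      l₀ a = solve (a ∷ [])
      l₁ : ∀ b c → b ≡ b + 0ℤ · (c - b)
      l₁ b c = solve (b ∷ c ∷ [])
      l₂ : ∀ a → a - 1ℤ ≡ a + -1ℤ · 1ℤ
      l₂ a = solve (a ∷ [])
      l₃ : ∀ b c → c ≡ b + 1ℤ · (c - b)
      l₃ b c = solve (b ∷ c ∷ [])
    step : ∀ J → rotᵐ (X (1ℤ + J)) (X J) ≡ X (1ℤ + (1ℤ + J))
    step J = begin
      rotᵐ (X (1ℤ + J)) (X J)
        ≡⟨ rotᵐ-above (h (1ℤ + J)) (h J) (≡-mod-reflexive (solve (a ∷ J ∷ []))) ⟩
      ⟪ a + -1ℤ · (1ℤ + J) - 1ℤ , + 2 · (b + (1ℤ + J) · (c - b)) - (b + J · (c - b)) ⟫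
        ≡⟨ cong₂ ⟪_,_⟫ (solve (a ∷ J ∷ [])) (solve (b ∷ c ∷ J ∷ [])) ⟩
      ⟪ a + -1ℤ · (1ℤ + (1ℤ + J)) , b + (1ℤ + (1ℤ + J)) · (c - b) ⟫ ∎
      where open ≡-Reasoning
    periodic : ∀ J → h (+ n + J) ≡ h J mod m
    periodic J = begin
      b + (+ n + J) · (c - b)        ≡⟨ lemma b c J (+ n) ⟩
      b + J · (c - b) + + n · (c - b) ≈⟨ +-congˡ-mod (h J) (n·≡0-mod-m (c - b)) ⟩
      b + J · (c - b) + 0ℤ           ≡⟨ ℤ.+-identityʳ (h J) ⟩
      h J                            ∎
      where
      open ≡-mod-Reasoning m
      lemma : ∀ b c J N → b + (N + J) · (c - b) ≡ b + J · (c - b) + N · (c - b)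
      lemma b c J N = solve (b ∷ c ∷ J ∷ N ∷ [])
    rotation-step : ∀ J → glide -1ℤ 0ℤ (c - b) (X J) ≡ X (1ℤ + J)
    rotation-step J = begin
      glide -1ℤ 0ℤ (c - b) (X J)                                        ≡⟨ glide-⟪⟫ -1ℤ 0ℤ (c - b) _ _ ⟩
      ⟪ a + -1ℤ · J + -1ℤ , b + J · (c - b) + 0ℤ · (a + -1ℤ · J) + (c - b) ⟫ ≡⟨ cong₂ ⟪_,_⟫ (solve (a ∷ J ∷ []))
                                                                                            (solve (a ∷ b ∷ c ∷ J ∷ [])) ⟩
      ⟪ a + -1ℤ · (1ℤ + J) , b + (1ℤ + J) · (c - b) ⟫                   ∎
      where open ≡-Reasoning

  ascending-face : ∀ a b c → Face (⟪ a , b ⟫ , ⟪ a + 1ℤ , c ⟫)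
  ascending-face a b c = record
    { origin = a ; direction = 1ℤ ; height = h ; direction² = refl
    ; boundary = λ j → trans (cong (iter (φ model) j) starts) (walk model (X ∘ +_) (λ j → step (+ j)) j)
    ; periodic = periodic
    ; rotation = glide 1ℤ (+ 4) (c - b - + 4 · a) ; rotation-aut = glide-aut 1ℤ (+ 4) (c - b - + 4 · a)
    ; rotation-step = rotation-step
    }
    where
    h : ℤ → ℤ
    h J = b + J · (c - b) + + 2 · (J · (J - 1ℤ))
    X : ℤ → V
    X J = ⟪ a + 1ℤ · J , h J ⟫
    starts : (⟪ a , b ⟫ , ⟪ a + 1ℤ , c ⟫) ≡ (X 0ℤ , X 1ℤ)
    starts = cong₂ _,_ (cong₂ ⟪_,_⟫ (l₀ a) (l₁ b c)) (cong₂ ⟪_,_⟫ (l₂ a) (l₃ b c))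
      where
      l₀ : ∀ a → a ≡ a + 1ℤ · 0ℤ
      l₀ a = solve (a ∷ [])
      l₁ : ∀ b c → b ≡ b + 0ℤ · (c - b) + + 2 · (0ℤ · (0ℤ - 1ℤ))
      l₁ b c = solve (b ∷ c ∷ [])
      l₂ : ∀ a → a + 1ℤ ≡ a + 1ℤ · 1ℤ
      l₂ a = solve (a ∷ [])
      l₃ : ∀ b c → c ≡ b + 1ℤ · (c - b) + + 2 · (1ℤ · (1ℤ - 1ℤ))
      l₃ b c = solve (b ∷ c ∷ [])
    step : ∀ J → rotᵐ (X (1ℤ + J)) (X J) ≡ X (1ℤ + (1ℤ + J))
    step J = begin
      rotᵐ (X (1ℤ + J)) (X J)
        ≡⟨ rotᵐ-below (h (1ℤ + J)) (h J) (≡-mod-reflexive (solve (a ∷ J ∷ []))) ⟩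
      ⟪ a + 1ℤ · (1ℤ + J) + 1ℤ , + 2 · (b + (1ℤ + J) · (c - b) + + 2 · ((1ℤ + J) · ((1ℤ + J) - 1ℤ)))
                                 - (b + J · (c - b) + + 2 · (J · (J - 1ℤ))) + + 4 ⟫
        ≡⟨ cong₂ ⟪_,_⟫ (solve (a ∷ J ∷ [])) (solve (b ∷ c ∷ J ∷ [])) ⟩
      ⟪ a + 1ℤ · (1ℤ + (1ℤ + J)) , b + (1ℤ + (1ℤ + J)) · (c - b) + + 2 · ((1ℤ + (1ℤ + J)) · ((1ℤ + (1ℤ + J)) - 1ℤ)) ⟫ ∎
      where open ≡-Reasoning
    periodic : ∀ J → h (+ n + J) ≡ h J mod m
    periodic J = begin
      h (+ n + J)                                              ≡⟨ lemma b c J (+ n) ⟩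
      h J + + n · (c - b + + 2 · (+ n + + 2 · J - 1ℤ))        ≈⟨ +-congˡ-mod (h J) (n·≡0-mod-m _) ⟩
      h J + 0ℤ                                                 ≡⟨ ℤ.+-identityʳ (h J) ⟩
      h J                                                      ∎
      where
      open ≡-mod-Reasoning m
      lemma : ∀ b c J N → b + (N + J) · (c - b) + + 2 · ((N + J) · ((N + J) - 1ℤ))
                          ≡ b + J · (c - b) + + 2 · (J · (J - 1ℤ)) + N · (c - b + + 2 · (N + + 2 · J - 1ℤ))
      lemma b c J N = solve (b ∷ c ∷ J ∷ N ∷ [])
    rotation-step : ∀ J → glide 1ℤ (+ 4) (c - b - + 4 · a) (X J) ≡ X (1ℤ + J)
    rotation-step J = begin
      glide 1ℤ (+ 4) (c - b - + 4 · a) (X J)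
        ≡⟨ glide-⟪⟫ 1ℤ (+ 4) (c - b - + 4 · a) _ _ ⟩
      ⟪ a + 1ℤ · J + 1ℤ , b + J · (c - b) + + 2 · (J · (J - 1ℤ)) + + 4 · (a + 1ℤ · J) + (c - b - + 4 · a) ⟫
        ≡⟨ cong₂ ⟪_,_⟫ (solve (a ∷ J ∷ [])) (solve (a ∷ b ∷ c ∷ J ∷ [])) ⟩
      ⟪ a + 1ℤ · (1ℤ + J) , b + (1ℤ + J) · (c - b) + + 2 · ((1ℤ + J) · ((1ℤ + J) - 1ℤ)) ⟫ ∎
      where open ≡-Reasoning

  face : ∀ u v → Adj u v → Face (u , v)
  face = adjacent-elim ascending-face descending-face

  model-polytopal : Polytopal model
  model-polytopal (u , v) adj = (n , faceLength , distinct) , no-swap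
    where open FaceProperties (face u v adj)

  r⁻¹ : Fin n → Fin n
  r⁻¹ i = modF n (toℤ i - 1ℤ)

  r-r⁻¹ : ∀ i → r (r⁻¹ i) ≡ i
  r-r⁻¹ i = trans (r-modF (toℤ i - 1ℤ)) (trans (modF-cong (≡-mod-reflexive (lemma (toℤ i)))) (modF-toℤ i))
    where
    lemma : ∀ x → x - 1ℤ + 1ℤ ≡ x
    lemma x = solve (x ∷ [])

  r⁻¹-r : ∀ i → r⁻¹ (r i) ≡ i
  r⁻¹-r i = begin
    modF n (toℤ (r i) - 1ℤ)            ≡⟨ cong (λ x → modF n (toℤ x - 1ℤ)) (r-toℤ i) ⟩
    modF n (toℤ (modF n (toℤ i + 1ℤ)) - 1ℤ) ≡⟨ modF-cong (+-congʳ-mod -1ℤ (toℤ-modF (toℤ i + 1ℤ))) ⟩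
    modF n (toℤ i + 1ℤ - 1ℤ)           ≡⟨ cong (modF n) (lemma (toℤ i)) ⟩
    modF n (toℤ i)                     ≡⟨ modF-toℤ i ⟩
    i                                  ∎
    where
    open ≡-Reasoning
    lemma : ∀ x → x + 1ℤ - 1ℤ ≡ x
    lemma x = solve (x ∷ [])

  r≢r⁻¹ : ∀ i → r i ≢ r⁻¹ i
  r≢r⁻¹ i eq = a+1≢a-1 (toℤ i) (modF-injective (trans (sym (r-toℤ i)) eq))

  neighbourLayer : Fin n → Fin 2 → Fin n
  neighbourLayer i Fin.zero    = r i
  neighbourLayer i (Fin.suc _) = r⁻¹ i

  neighbourLayer-injective : ∀ i {e e′} → neighbourLayer i e ≡ neighbourLayer i e′ → e ≡ e′
  neighbourLayer-injective i {Fin.zero}          {Fin.zero}          _  = refl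
  neighbourLayer-injective i {Fin.suc Fin.zero}  {Fin.suc Fin.zero}  _  = refl
  neighbourLayer-injective i {Fin.zero}          {Fin.suc Fin.zero}  eq = ⊥-elim (r≢r⁻¹ i eq)
  neighbourLayer-injective i {Fin.suc Fin.zero}  {Fin.zero}          eq = ⊥-elim (r≢r⁻¹ i (sym eq))

  neighbours : Fin n → Fin (2 ℕ.* m) → V
  neighbours i k = neighbourLayer i (proj₁ (Fin.remQuot {2} m k)) , proj₂ (Fin.remQuot {2} m k)

  degree : ∀ u → Degree model u (2 ℕ.* m)
  degree (i , y) = neighbours i , injective , adjacent , surjective
    where
    injective : ∀ {k k′} → neighbours i k ≡ neighbours i k′ → k ≡ k′
    injective {k} {k′} eq = begin
      k                                  ≡⟨ Fin.combine-remQuot {2} m k ⟨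
      uncurry Fin.combine (Fin.remQuot {2} m k)  ≡⟨ cong (uncurry Fin.combine) remQuot≡ ⟩
      uncurry Fin.combine (Fin.remQuot {2} m k′) ≡⟨ Fin.combine-remQuot {2} m k′ ⟩
      k′                                 ∎
      where
      open ≡-Reasoning
      remQuot≡ : Fin.remQuot {2} m k ≡ Fin.remQuot {2} m k′
      remQuot≡ = cong₂ _,_ (neighbourLayer-injective i (cong proj₁ eq)) (cong proj₂ eq)
    adjacent-layer : ∀ e y′ → Adj (i , y) (neighbourLayer i e , y′)
    adjacent-layer Fin.zero    _ = inj₂ refl
    adjacent-layer (Fin.suc _) _ = inj₁ (sym (r-r⁻¹ i))
    adjacent : ∀ k → Adj (i , y) (neighbours i k)
    adjacent k = adjacent-layer (proj₁ (Fin.remQuot {2} m k)) (proj₂ (Fin.remQuot {2} m k))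
    surjective : ∀ v → Adj (i , y) v → ∃ λ k → neighbours i k ≡ v
    surjective (i′ , y′) (inj₂ i′≡ri) =
      Fin.combine {2} {m} Fin.zero y′
      , trans (cong (λ q → neighbourLayer i (proj₁ q) , proj₂ q) (Fin.remQuot-combine {2} {m} Fin.zero y′))
                                      (cong (_, y′) (sym i′≡ri))
    surjective (i′ , y′) (inj₁ i≡ri′) =
      Fin.combine {2} {m} (Fin.suc Fin.zero) y′
      , trans (cong (λ q → neighbourLayer i (proj₁ q) , proj₂ q) (Fin.remQuot-combine {2} {m} (Fin.suc Fin.zero) y′))
                                                (cong (_, y′) (trans (cong r⁻¹ i≡ri′) (r⁻¹-r i′)))

  model-hasType : HasType model n (2 ℕ.* m)
  model-hasType = (λ { (u , v) adj → FaceProperties.faceLength (face u v adj) }) , degree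

  vertexRotation : ℤ → ℤ → V → V
  vertexRotation a b = turn (+ 2 · a) (- (+ 4 · a + + 2)) (+ 2 · b + + 2 · (a · a) + + 2 · a)

  vertexRotation-fixes : ∀ a b → vertexRotation a b ⟪ a , b ⟫ ≡ ⟪ a , b ⟫
  vertexRotation-fixes a b = trans (turn-⟪⟫ (+ 2 · a) (- (+ 4 · a + + 2)) (+ 2 · b + + 2 · (a · a) + + 2 · a) a b)
                                   (cong₂ ⟪_,_⟫ (solve (a ∷ [])) (solve (a ∷ b ∷ [])))

  vertexRotation-acts : ∀ a b v → Adj ⟪ a , b ⟫ v → vertexRotation a b v ≡ rotᵐ ⟪ a , b ⟫ v
  vertexRotation-acts a b v adj = acts (neighbour {a} {b} adj)
    where
    open ≡-Reasoning
    acts : ∀ {v} → Neighbour a v → vertexRotation a b v ≡ rotᵐ ⟪ a , b ⟫ v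
    acts (above c) = begin
      vertexRotation a b ⟪ a + 1ℤ , c ⟫
        ≡⟨ turn-⟪⟫ (+ 2 · a) (- (+ 4 · a + + 2)) (+ 2 · b + + 2 · (a · a) + + 2 · a) (a + 1ℤ) c ⟩
      ⟪ + 2 · a - (a + 1ℤ) , - c + + 2 · ((a + 1ℤ) · (a + 1ℤ)) + - (+ 4 · a + + 2) · (a + 1ℤ)
                               + (+ 2 · b + + 2 · (a · a) + + 2 · a) ⟫
        ≡⟨ cong₂ ⟪_,_⟫ (solve (a ∷ [])) (solve (a ∷ b ∷ c ∷ [])) ⟩
      ⟪ a - 1ℤ , + 2 · b - c ⟫
        ≡⟨ rotᵐ-above b c ≡-mod-refl ⟨
      rotᵐ ⟪ a , b ⟫ ⟪ a + 1ℤ , c ⟫ ∎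
    acts (below c) = begin
      vertexRotation a b ⟪ a - 1ℤ , c ⟫
        ≡⟨ turn-⟪⟫ (+ 2 · a) (- (+ 4 · a + + 2)) (+ 2 · b + + 2 · (a · a) + + 2 · a) (a - 1ℤ) c ⟩
      ⟪ + 2 · a - (a - 1ℤ) , - c + + 2 · ((a - 1ℤ) · (a - 1ℤ)) + - (+ 4 · a + + 2) · (a - 1ℤ)
                               + (+ 2 · b + + 2 · (a · a) + + 2 · a) ⟫
        ≡⟨ cong₂ ⟪_,_⟫ (solve (a ∷ [])) (solve (a ∷ b ∷ c ∷ [])) ⟩
      ⟪ a + 1ℤ , + 2 · b - c + + 4 ⟫
        ≡⟨ rotᵐ-below b c ≡-mod-refl ⟨
      rotᵐ ⟪ a , b ⟫ ⟪ a - 1ℤ , c ⟫ ∎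

  model-rotary : Rotary model
  model-rotary = points-elim vertexRotations , faceRotations
    where
    vertexRotations : ∀ a b → ∃ λ g → IsAut model g × g ⟪ a , b ⟫ ≡ ⟪ a , b ⟫
                      × (∀ v w → Adj ⟪ a , b ⟫ v → Adj ⟪ a , b ⟫ w → ∃ λ k → iter g k v ≡ w)
    vertexRotations a b =
      vertexRotation a b , inj₁ (turn-aut (+ 2 · a) (- (+ 4 · a + + 2)) (+ 2 · b + + 2 · (a · a) + + 2 · a))
      , vertexRotation-fixes a b , transitive
      where
      transitive : ∀ v w → Adj ⟪ a , b ⟫ v → Adj ⟪ a , b ⟫ w → ∃ λ k → iter (vertexRotation a b) k v ≡ w
      transitive v w av aw with rotᵐ-cyclic a b (neighbour {a} {b} av) (neighbour {a} {b} aw)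
      ... | k , p = k , trans (iter-cong {P = Adj ⟪ a , b ⟫} (vertexRotation-acts a b)
                                         (RotSys.rot-adj model ⟪ a , b ⟫) k v av) p
    faceRotations : ∀ d → IsDart model d → ∃ λ g → IsAut model g × StabFace model g d
                    × (∀ k → ∃ λ e → iter g e (fv model d 0) ≡ fv model d k)
    faceRotations (u , v) adj = rotation , inj₁ rotation-aut , stabFace , λ k → k , rotation-transitive k
      where
      open Face (face u v adj)
      open FaceProperties (face u v adj)

  base : Dart
  base = (⟪ 0ℤ , 0ℤ ⟫ , ⟪ -1ℤ , 0ℤ ⟫)

  base-adj : IsDart model base
  base-adj = adj-below ≡-mod-refl

  base-fv : ∀ j → fv model base j ≡ ⟪ - + j , 0ℤ ⟫
  base-fv j = trans (FaceProperties.fv-vertex (descending-face 0ℤ 0ℤ 0ℤ) j) (cong₂ ⟪_,_⟫ (l₀ (+ j)) (l₁ (+ j)))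
    where
    l₀ : ∀ J → 0ℤ + -1ℤ · J ≡ - J
    l₀ J = solve (J ∷ [])
    l₁ : ∀ J → 0ℤ + J · (0ℤ - 0ℤ) ≡ 0ℤ
    l₁ J = solve (J ∷ [])

  model-reflexible : Reflexible model
  model-reflexible = model-rotary , base , base-adj , flip 0ℤ 0ℤ 0ℤ , inj₂ (flip-aut 0ℤ 0ℤ 0ℤ)
             , (λ j → proj₁ (reflects j) , inj₂ (proj₂ (reflects j))) , reflects
    where
    flip-base : ∀ j k → + j ≡ - + k mod n → flip 0ℤ 0ℤ 0ℤ (fv model base j) ≡ fv model base k
    flip-base j k j≡-k = begin
      flip 0ℤ 0ℤ 0ℤ (fv model base j)  ≡⟨ cong (flip 0ℤ 0ℤ 0ℤ) (base-fv j) ⟩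
      flip 0ℤ 0ℤ 0ℤ ⟪ - + j , 0ℤ ⟫     ≡⟨ flip-⟪⟫ 0ℤ 0ℤ 0ℤ (- + j) 0ℤ ⟩
      ⟪ 0ℤ - - + j , 0ℤ + 0ℤ + 0ℤ ⟫
        ≡⟨ ⟪⟫-cong (≡-mod-trans (≡-mod-reflexive (trans (ℤ.+-identityˡ (- - + j)) (ℤ.neg-involutive (+ j)))) j≡-k) ≡-mod-refl ⟩
      ⟪ - + k , 0ℤ ⟫                   ≡⟨ base-fv k ⟨
      fv model base k                  ∎
      where open ≡-Reasoning
    reflects : ReflectsFace model (flip 0ℤ 0ℤ 0ℤ) base
    reflects j = k , flip-base j (suc k) layer₀ , flip-base (suc j) k layer₁
      where
      open ≡-mod-Reasoning n
      k = toℕ (modF n (- (1ℤ + + j)))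
      k≡ : + k ≡ - (1ℤ + + j) mod n
      k≡ = subst (_≡ - (1ℤ + + j) mod n) (toℤ-def _) (toℤ-modF (- (1ℤ + + j)))
      l₀ : ∀ J → J ≡ - (1ℤ + - (1ℤ + J))
      l₀ J = solve (J ∷ [])
      layer₀ : + j ≡ - (1ℤ + + k) mod n
      layer₀ = begin
        + j                       ≡⟨ l₀ (+ j) ⟩
        - (1ℤ + - (1ℤ + + j))     ≈⟨ -‿cong-mod (+-congˡ-mod 1ℤ (≡-mod-sym k≡)) ⟩
        - (1ℤ + + k)              ∎
      layer₁ : 1ℤ + + j ≡ - + k mod n
      layer₁ = begin
        1ℤ + + j                  ≡⟨ ℤ.neg-involutive (1ℤ + + j) ⟨
        - - (1ℤ + + j)            ≈⟨ -‿cong-mod (≡-mod-sym k≡) ⟩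
        - + k                     ∎

  model-distinguished : Distinguished model η₁ᵐ η₂ᵐ
  model-distinguished =
    base , base-adj , glide-aut 1ℤ 0ℤ 0ℤ , turn-aut 0ℤ (- + 2) 0ℤ , inj₂ rotatesFace
    , (vertexRotation-fixes 0ℤ 0ℤ , inj₁ (vertexRotation-acts 0ℤ 0ℤ)) , involution
    , 0 , inj₁ refl
    , trans (η₁ᵐ⨾η₂ᵐ _) (turn-⟪⟫ -1ℤ (+ 2) 0ℤ 0ℤ 0ℤ) , trans (η₁ᵐ⨾η₂ᵐ _) (turn-⟪⟫ -1ℤ (+ 2) 0ℤ -1ℤ 0ℤ)
    where
    rotatesFace : ∀ j → η₁ᵐ (fv model base (suc j)) ≡ fv model base j
    rotatesFace j = begin
      η₁ᵐ (fv model base (suc j))          ≡⟨ cong η₁ᵐ (base-fv (suc j)) ⟩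
      η₁ᵐ ⟪ - (1ℤ + + j) , 0ℤ ⟫            ≡⟨ glide-⟪⟫ 1ℤ 0ℤ 0ℤ _ _ ⟩
      ⟪ - (1ℤ + + j) + 1ℤ , 0ℤ ⟫           ≡⟨ cong ⟪_, 0ℤ ⟫ (lemma (+ j)) ⟩
      ⟪ - + j , 0ℤ ⟫                       ≡⟨ base-fv j ⟨
      fv model base j                      ∎
      where
      open ≡-Reasoning
      lemma : ∀ J → - (1ℤ + J) + 1ℤ ≡ - J
      lemma J = solve (J ∷ [])
    involution : ∀ x → (η₁ᵐ ⨾ η₂ᵐ ⨾ η₁ᵐ ⨾ η₂ᵐ) x ≡ x
    involution x = begin
      (η₁ᵐ ⨾ η₂ᵐ ⨾ η₁ᵐ ⨾ η₂ᵐ) x                    ≡⟨ η₁ᵐ⨾η₂ᵐ _ ⟩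
      turn -1ℤ (+ 2) 0ℤ ((η₁ᵐ ⨾ η₂ᵐ) x)            ≡⟨ cong (turn -1ℤ (+ 2) 0ℤ) (η₁ᵐ⨾η₂ᵐ x) ⟩
      turn -1ℤ (+ 2) 0ℤ (turn -1ℤ (+ 2) 0ℤ x)      ≡⟨ turn-turn -1ℤ (+ 2) 0ℤ -1ℤ (+ 2) 0ℤ x ⟩
      glide 0ℤ 0ℤ 0ℤ x                             ≡⟨ glide-identity x ⟩
      x                                            ∎
      where open ≡-Reasoning

module Generators (n m : ℕ) .{{_ : NonZero n}} .{{_ : NonZero m}} (m∣n : m ℕ.∣ n)
                  (h : ℕ) (n≡2h+1 : n ≡ suc (h ℕ.+ h)) where
  open Lex n m
  open Maps n m
  open IntegerPoints n m m∣n

  fibreOf : Fin n → Fin m → ℤ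
  fibreOf i j = fibre (toℕ i) (toℤ j)

  toModel : V → V
  toModel (i , j) = (i , modF m (fibreOf i j))

  fromModel : V → V
  fromModel (i , y) = (i , modF m (alt (toℕ i) (toℤ y - offset (toℕ i))))

  fromModel∘toModel : ∀ x → fromModel (toModel x) ≡ x
  fromModel∘toModel (i , j) = cong (i ,_) (trans (modF-cong (begin
    alt I (toℤ (modF m (alt I (toℤ j) + D)) - D)  ≈⟨ alt-cong-mod I (+-congʳ-mod (- D) (toℤ-modF (alt I (toℤ j) + D))) ⟩
    alt I (alt I (toℤ j) + D - D)                 ≡⟨ cong (alt I) (lemma (alt I (toℤ j)) D) ⟩
    alt I (alt I (toℤ j))                         ≡⟨ alt-involutive I (toℤ j) ⟩
    toℤ j                                         ∎)) (modF-toℤ j))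
    where
    open ≡-mod-Reasoning m
    I = toℕ i
    D = offset I
    lemma : ∀ x d → x + d - d ≡ x
    lemma x d = solve (x ∷ d ∷ [])

  toModel∘fromModel : ∀ x → toModel (fromModel x) ≡ x
  toModel∘fromModel (i , y) = cong (i ,_) (trans (modF-cong (begin
    alt I (toℤ (modF m (alt I (toℤ y - D)))) + D  ≈⟨ +-congʳ-mod D (alt-cong-mod I (toℤ-modF (alt I (toℤ y - D)))) ⟩
    alt I (alt I (toℤ y - D)) + D                 ≡⟨ cong (_+ D) (alt-involutive I _) ⟩
    toℤ y - D + D                                 ≡⟨ lemma (toℤ y) D ⟩
    toℤ y                                         ∎)) (modF-toℤ y))
    where
    open ≡-mod-Reasoning m
    I = toℕ i
    D = offset I
    lemma : ∀ x d → x - d + d ≡ x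
    lemma x d = solve (x ∷ d ∷ [])

  ψ : Relabelling
  ψ = record
    { to = toModel ; from = fromModel ; from∘to = fromModel∘toModel ; to∘from = toModel∘fromModel
    ; to-adj = id ; from-adj = id }

  0<n : 0 ℕ.< n
  0<n = ℕ.>-nonZero⁻¹ n

  toℤ-r : ∀ i → toℤ (r i) ≡ toℤ i + 1ℤ mod n
  toℤ-r i = subst (λ x → toℤ x ≡ toℤ i + 1ℤ mod n) (sym (r-toℤ i)) (toℤ-modF (toℤ i + 1ℤ))

  toℤ-z : ∀ i → toℤ (z i) ≡ - toℤ i mod n
  toℤ-z i = subst (λ x → toℤ (z i) ≡ - x mod n) (sym (toℤ-def i)) (toℤ-modF (- (+ toℕ i)))

  z-involutive : ∀ i → z (z i) ≡ i
  z-involutive i = toℤ-injective-mod (begin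
    toℤ (z (z i))   ≈⟨ toℤ-z (z i) ⟩
    - toℤ (z i)     ≈⟨ -‿cong-mod (toℤ-z i) ⟩
    - - toℤ i       ≡⟨ ℤ.neg-involutive (toℤ i) ⟩
    toℤ i           ∎)
    where open ≡-mod-Reasoning n

  toℕ-r-wrap : ∀ i → toℕ i ≡ ℕ.pred n → toℕ (r i) ≡ 0
  toℕ-r-wrap i wrap = toℕ-modF 0<n (begin
    + toℕ i + 1ℤ         ≡⟨ cong (λ k → + k + 1ℤ) (trans wrap (cong ℕ.pred n≡2h+1)) ⟩
    + (h ℕ.+ h) + 1ℤ     ≡⟨ trans (ℤ.+-comm (+ (h ℕ.+ h)) 1ℤ) (cong +_ (sym n≡2h+1)) ⟩
    + n                  ≈⟨ k≡0-mod ⟩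
    0ℤ                   ∎)
    where open ≡-mod-Reasoning n

  toℕ-r-step : ∀ i → toℕ i ≢ ℕ.pred n → toℕ (r i) ≡ suc (toℕ i)
  toℕ-r-step i ¬wrap = toℕ-modF (ℕ.≤∧≢⇒< (Fin.toℕ<n i) (λ eq → ¬wrap (cong ℕ.pred eq)))
                                (≡-mod-reflexive (sym (+-suc (toℕ i))))

  toℕ-z-zero : ∀ i → toℕ i ≡ 0 → toℕ (z i) ≡ 0
  toℕ-z-zero i i≡0 = toℕ-modF 0<n (≡-mod-reflexive (cong (λ k → - (+ k)) i≡0))

  toℕ-z-step : ∀ i → toℕ i ≢ 0 → toℕ (z i) ≢ 0
  toℕ-z-step i i≢0 zi≡0 = i≢0 (trans (cong toℕ (sym (z-involutive i))) (toℕ-z-zero (z i) zi≡0))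

  toℕ-z-suc : ∀ i k → toℕ i ≡ suc k → toℕ (z i) ≡ n ℕ.∸ suc k
  toℕ-z-suc i k i≡1+k = toℕ-modF (ℕ.∸-monoʳ-< (ℕ.s≤s ℕ.z≤n) 1+k≤n) (begin
    - (+ toℕ i)                 ≡⟨ cong (λ x → - (+ x)) i≡1+k ⟩
    - + suc k                   ≡⟨ ℤ.+-identityˡ (- + suc k) ⟨
    0ℤ - + suc k                ≈⟨ +-congʳ-mod (- + suc k) (≡-mod-sym k≡0-mod) ⟩
    + n - + suc k               ≡⟨ ℤ.m-n≡m⊖n n (suc k) ⟩
    n ℤ.⊖ suc k                 ≡⟨ ℤ.⊖-≥ 1+k≤n ⟩
    + (n ℕ.∸ suc k)             ∎)
    where
    open ≡-mod-Reasoning n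
    1+k≤n : suc k ℕ.≤ n
    1+k≤n = ℕ.<⇒≤ (subst (ℕ._< n) i≡1+k (Fin.toℕ<n i))

  σ₁-wrap : ∀ i j → toℕ i ≡ ℕ.pred n → σ₁ (i , j) ≡ (r i , tc⁻¹ j)
  σ₁-wrap i j wrap with toℕ i ℕ.≟ ℕ.pred n
  ... | yes _    = refl
  ... | no ¬wrap = ⊥-elim (¬wrap wrap)

  σ₁-step : ∀ i j → toℕ i ≢ ℕ.pred n → σ₁ (i , j) ≡ (r i , j)
  σ₁-step i j ¬wrap with toℕ i ℕ.≟ ℕ.pred n
  ... | yes wrap = ⊥-elim (¬wrap wrap)
  ... | no _     = refl

  σ₂-zero : ∀ i j → toℕ i ≡ 0 → σ₂ (i , j) ≡ (z i , t j)
  σ₂-zero i j i≡0 with toℕ i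
  σ₂-zero i j refl | .zero = refl

  σ₂-suc : ∀ i j k → toℕ i ≡ suc k → σ₂ (i , j) ≡ (z i , β (suc k) j)
  σ₂-suc i j k i≡1+k with toℕ i
  σ₂-suc i j k refl | .(suc k) = refl

  ρ-zero : ∀ i j → toℕ i ≡ 0 → ρ (i , j) ≡ (z i , j)
  ρ-zero i j i≡0 with toℕ i
  ρ-zero i j refl | .zero = refl

  ρ-nonzero : ∀ i j → toℕ i ≢ 0 → ρ (i , j) ≡ (z i , tc⁻¹ j)
  ρ-nonzero i j i≢0 with toℕ i
  ... | zero  = ⊥-elim (i≢0 refl)
  ... | suc _ = refl

  η₁-wrap : ∀ i j → toℕ i ≡ ℕ.pred n → η₁ (i , j) ≡ (r i , t (tc⁻¹ j))
  η₁-wrap i j wrap = begin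
    ρ (σ₂ (σ₁ (i , j)))          ≡⟨ cong (ρ ∘ σ₂) (σ₁-wrap i j wrap) ⟩
    ρ (σ₂ (r i , tc⁻¹ j))        ≡⟨ cong ρ (σ₂-zero (r i) (tc⁻¹ j) (toℕ-r-wrap i wrap)) ⟩
    ρ (z (r i) , t (tc⁻¹ j))     ≡⟨ ρ-zero (z (r i)) _ (toℕ-z-zero (r i) (toℕ-r-wrap i wrap)) ⟩
    (z (z (r i)) , t (tc⁻¹ j))   ≡⟨ cong (_, t (tc⁻¹ j)) (z-involutive (r i)) ⟩
    (r i , t (tc⁻¹ j))           ∎
    where open ≡-Reasoning

  η₁-step : ∀ i j → toℕ i ≢ ℕ.pred n → η₁ (i , j) ≡ (r i , tc⁻¹ (β (suc (toℕ i)) j))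
  η₁-step i j ¬wrap = begin
    ρ (σ₂ (σ₁ (i , j)))                        ≡⟨ cong (ρ ∘ σ₂) (σ₁-step i j ¬wrap) ⟩
    ρ (σ₂ (r i , j))                           ≡⟨ cong ρ (σ₂-suc (r i) j (toℕ i) (toℕ-r-step i ¬wrap)) ⟩
    ρ (z (r i) , β (suc (toℕ i)) j)            ≡⟨ ρ-nonzero (z (r i)) _ (toℕ-z-step (r i) r≢0) ⟩
    (z (z (r i)) , tc⁻¹ (β (suc (toℕ i)) j))   ≡⟨ cong (_, tc⁻¹ (β (suc (toℕ i)) j)) (z-involutive (r i)) ⟩
    (r i , tc⁻¹ (β (suc (toℕ i)) j))           ∎
    where
    open ≡-Reasoning
    r≢0 : toℕ (r i) ≢ 0
    r≢0 eq with trans (sym (toℕ-r-step i ¬wrap)) eq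
    ... | ()

  toℤ-t : ∀ x → toℤ (t x) ≡ - toℤ x mod m
  toℤ-t x = subst (λ y → toℤ (t x) ≡ - y mod m) (sym (toℤ-def x)) (toℤ-modF (- (+ toℕ x)))

  toℤ-cPow : ∀ k x → toℤ (cPow k x) ≡ toℤ x + k mod m
  toℤ-cPow k x = subst (λ y → toℤ (cPow k x) ≡ y + k mod m) (sym (toℤ-def x)) (toℤ-modF (+ toℕ x + k))

  toℤ-tc⁻¹ : ∀ x → toℤ (tc⁻¹ x) ≡ - toℤ x - 1ℤ mod m
  toℤ-tc⁻¹ x = ≡-mod-trans (toℤ-cPow -1ℤ (t x)) (+-congʳ-mod -1ℤ (toℤ-t x))

  toℤ-β : ∀ k x → toℤ (β k x) ≡ toℤ x + alt k (+ 2 · + k - 1ℤ) mod m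
  toℤ-β k x = subst (λ e → toℤ (β k x) ≡ toℤ x + alt k (e - 1ℤ) mod m) (ℤ.pos-* 2 k) (toℤ-cPow _ x)

  toModel-⟪⟫ : ∀ i j → toModel (i , j) ≡ ⟪ toℤ i , fibreOf i j ⟫
  toModel-⟪⟫ i j = trans (cong (_, modF m (fibreOf i j)) (sym (modF-toℤ i))) (sym (⟪⟫-def (toℤ i) (fibreOf i j)))

  toModel-shift : ∀ i j i′ j′ → toℤ i′ ≡ toℤ i + 1ℤ mod n → fibreOf i′ j′ ≡ fibreOf i j mod m →
                  toModel (i′ , j′) ≡ η₁ᵐ (toModel (i , j))
  toModel-shift i j i′ j′ layer fibre≡ = begin
    toModel (i′ , j′)                                 ≡⟨ toModel-⟪⟫ i′ j′ ⟩
    ⟪ toℤ i′ , fibreOf i′ j′ ⟫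
      ≡⟨ ⟪⟫-cong layer (≡-mod-trans fibre≡ (≡-mod-reflexive (lemma (fibreOf i j) (toℤ i)))) ⟩
    ⟪ toℤ i + 1ℤ , fibreOf i j + 0ℤ · toℤ i + 0ℤ ⟫      ≡⟨ glide-⟪⟫ 1ℤ 0ℤ 0ℤ (toℤ i) (fibreOf i j) ⟨
    η₁ᵐ ⟪ toℤ i , fibreOf i j ⟫                         ≡⟨ cong η₁ᵐ (toModel-⟪⟫ i j) ⟨
    η₁ᵐ (toModel (i , j))                             ∎
    where
    open ≡-Reasoning
    lemma : ∀ y x → y ≡ y + 0ℤ · x + 0ℤ
    lemma y x = solve (y ∷ x ∷ [])

  toModel-turn : ∀ i j i′ j′ → toℤ i′ ≡ - toℤ i mod n →
                 fibreOf i′ j′ ≡ - fibreOf i j + + 2 · (toℤ i · toℤ i) + - + 2 · toℤ i + 0ℤ mod m →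
                 toModel (i′ , j′) ≡ η₂ᵐ (toModel (i , j))
  toModel-turn i j i′ j′ layer fibre≡ = begin
    toModel (i′ , j′)                                 ≡⟨ toModel-⟪⟫ i′ j′ ⟩
    ⟪ toℤ i′ , fibreOf i′ j′ ⟫
      ≡⟨ ⟪⟫-cong (≡-mod-trans layer (≡-mod-reflexive (sym (ℤ.+-identityˡ (- toℤ i))))) fibre≡ ⟩
    ⟪ 0ℤ - toℤ i , - fibreOf i j + + 2 · (toℤ i · toℤ i) + - + 2 · toℤ i + 0ℤ ⟫
                                                      ≡⟨ turn-⟪⟫ 0ℤ (- + 2) 0ℤ (toℤ i) (fibreOf i j) ⟨
    η₂ᵐ ⟪ toℤ i , fibreOf i j ⟫                         ≡⟨ cong η₂ᵐ (toModel-⟪⟫ i j) ⟨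
    η₂ᵐ (toModel (i , j))                             ∎
    where open ≡-Reasoning

  fibreOf-at : ∀ {i} {k} → toℕ i ≡ k → ∀ x → fibreOf i x ≡ fibre k (toℤ x)
  fibreOf-at eq x = cong (λ k → fibre k (toℤ x)) eq

  [n-1]²≡1 : + (h ℕ.+ h) · + (h ℕ.+ h) ≡ 1ℤ mod m
  [n-1]²≡1 = begin
    H · H                        ≡⟨ lemma H ⟩
    1ℤ + (1ℤ + H) · (H - 1ℤ)     ≡⟨ cong (λ N → 1ℤ + + N · (H - 1ℤ)) n≡2h+1 ⟨
    1ℤ + + n · (H - 1ℤ)          ≈⟨ +-congˡ-mod 1ℤ (n·≡0-mod-m (H - 1ℤ)) ⟩
    1ℤ + 0ℤ                      ≡⟨ ℤ.+-identityʳ 1ℤ ⟩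
    1ℤ                           ∎
    where
    open ≡-mod-Reasoning m
    H = + (h ℕ.+ h)
    lemma : ∀ H → H · H ≡ 1ℤ + (1ℤ + H) · (H - 1ℤ)
    lemma H = solve (H ∷ [])

  fibreOf-wrap : ∀ i j → toℕ i ≡ ℕ.pred n → fibreOf (r i) (t (tc⁻¹ j)) ≡ fibreOf i j mod m
  fibreOf-wrap i j wrap = begin
    fibreOf (r i) (t (tc⁻¹ j))   ≡⟨ fibreOf-at (toℕ-r-wrap i wrap) (t (tc⁻¹ j)) ⟩
    toℤ (t (tc⁻¹ j)) + 0ℤ        ≈⟨ +-congʳ-mod 0ℤ (≡-mod-trans (toℤ-t (tc⁻¹ j)) (-‿cong-mod (toℤ-tc⁻¹ j))) ⟩
    - (- toℤ j - 1ℤ) + 0ℤ        ≡⟨ lemma (toℤ j) ⟩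
    toℤ j + 1ℤ                   ≈⟨ +-congˡ-mod (toℤ j) (≡-mod-sym [n-1]²≡1) ⟩
    toℤ j + H · H                ≡⟨ fibre-double h (toℤ j) ⟨
    fibre (h ℕ.+ h) (toℤ j)      ≡⟨ fibreOf-at (trans wrap (cong ℕ.pred n≡2h+1)) j ⟨
    fibreOf i j                  ∎
    where
    open ≡-mod-Reasoning m
    H = + (h ℕ.+ h)
    lemma : ∀ x → - (- x - 1ℤ) + 0ℤ ≡ x + 1ℤ
    lemma x = solve (x ∷ [])

  fibreOf-step : ∀ i j → toℕ i ≢ ℕ.pred n → fibreOf (r i) (tc⁻¹ (β (suc (toℕ i)) j)) ≡ fibreOf i j mod m
  fibreOf-step i j ¬wrap = begin
    fibreOf (r i) (tc⁻¹ (β (suc k) j))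
      ≡⟨ fibreOf-at (toℕ-r-step i ¬wrap) (tc⁻¹ (β (suc k) j)) ⟩
    fibre (suc k) (toℤ (tc⁻¹ (β (suc k) j)))
      ≈⟨ fibre-cong-mod (suc k) (≡-mod-trans (toℤ-tc⁻¹ _) (+-congʳ-mod -1ℤ (-‿cong-mod (toℤ-β (suc k) j)))) ⟩
    fibre (suc k) (- (toℤ j + alt (suc k) (+ 2 · (1ℤ + + k) - 1ℤ)) - 1ℤ)
      ≡⟨ fibre-suc k (toℤ j) ⟩
    fibreOf i j ∎
    where
    open ≡-mod-Reasoning m
    k = toℕ i

  fibreOf-turn-zero : ∀ i j → toℕ i ≡ 0 →
                      fibreOf (z i) (t j) ≡ - fibreOf i j + + 2 · (toℤ i · toℤ i) + - + 2 · toℤ i + 0ℤ mod m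
  fibreOf-turn-zero i j i≡0 = begin
    fibreOf (z i) (t j)                                   ≡⟨ fibreOf-at (toℕ-z-zero i i≡0) (t j) ⟩
    toℤ (t j) + 0ℤ                                        ≈⟨ +-congʳ-mod 0ℤ (toℤ-t j) ⟩
    - toℤ j + 0ℤ                                          ≡⟨ lemma (toℤ j) ⟩
    - (toℤ j + 0ℤ) + + 2 · (0ℤ · 0ℤ) + - + 2 · 0ℤ + 0ℤ    ≡⟨ cong₂ (λ F I → - F + + 2 · (I · I) + - + 2 · I + 0ℤ)
                                                                (fibreOf-at i≡0 j) (trans (toℤ-def i) (cong +_ i≡0)) ⟨
    - fibreOf i j + + 2 · (toℤ i · toℤ i) + - + 2 · toℤ i + 0ℤ ∎
    where
    open ≡-mod-Reasoning m
    lemma : ∀ x → - x + 0ℤ ≡ - (x + 0ℤ) + + 2 · (0ℤ · 0ℤ) + - + 2 · 0ℤ + 0ℤ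
    lemma x = solve (x ∷ [])

  fibreOf-turn-suc : ∀ i j k → toℕ i ≡ suc k →
                     fibreOf (z i) (β (suc k) j) ≡ - fibreOf i j + + 2 · (toℤ i · toℤ i) + - + 2 · toℤ i + 0ℤ mod m
  fibreOf-turn-suc i j k i≡1+k = begin
    fibreOf (z i) (β A j)
      ≡⟨ fibreOf-at (toℕ-z-suc i k i≡1+k) (β A j) ⟩
    fibre w (toℤ (β A j))
      ≈⟨ fibre-cong-mod w (toℤ-β A j) ⟩
    fibre w (toℤ j + alt A (+ 2 · + A - 1ℤ))
      ≡⟨ fibre-complement A w (toℤ j) (sgn-odd-sum w A {h} (trans w+A≡n n≡2h+1)) ⟩
    - fibre A (toℤ j) + + 2 · (+ A · + A) + - + 2 · + A + + (w ℕ.+ A) · (+ w - + A)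
      ≡⟨ cong (λ N → - fibre A (toℤ j) + + 2 · (+ A · + A) + - + 2 · + A + + N · (+ w - + A)) w+A≡n ⟩
    - fibre A (toℤ j) + + 2 · (+ A · + A) + - + 2 · + A + + n · (+ w - + A)
      ≈⟨ +-congˡ-mod (- fibre A (toℤ j) + + 2 · (+ A · + A) + - + 2 · + A) (n·≡0-mod-m (+ w - + A)) ⟩
    - fibre A (toℤ j) + + 2 · (+ A · + A) + - + 2 · + A + 0ℤ
      ≡⟨ cong₂ (λ F I → - F + + 2 · (I · I) + - + 2 · I + 0ℤ) (fibreOf-at i≡1+k j) (trans (toℤ-def i) (cong +_ i≡1+k)) ⟨
    - fibreOf i j + + 2 · (toℤ i · toℤ i) + - + 2 · toℤ i + 0ℤ ∎
    where
    open ≡-mod-Reasoning m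
    A = suc k
    w = n ℕ.∸ A
    w+A≡n : w ℕ.+ A ≡ n
    w+A≡n = ℕ.m∸n+n≡m (ℕ.<⇒≤ (subst (ℕ._< n) i≡1+k (Fin.toℕ<n i)))

  η₁-conj′ : ∀ i j → Dec (toℕ i ≡ ℕ.pred n) → toModel (η₁ (i , j)) ≡ η₁ᵐ (toModel (i , j))
  η₁-conj′ i j (yes wrap) =
    trans (cong toModel (η₁-wrap i j wrap)) (toModel-shift i j (r i) _ (toℤ-r i) (fibreOf-wrap i j wrap))
  η₁-conj′ i j (no ¬wrap) =
    trans (cong toModel (η₁-step i j ¬wrap)) (toModel-shift i j (r i) _ (toℤ-r i) (fibreOf-step i j ¬wrap))

  η₁-conj : ∀ x → toModel (η₁ x) ≡ η₁ᵐ (toModel x)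
  η₁-conj (i , j) = η₁-conj′ i j (toℕ i ℕ.≟ ℕ.pred n)

  η₂-conj′ : ∀ i j k → toℕ i ≡ k → toModel (η₂ (i , j)) ≡ η₂ᵐ (toModel (i , j))
  η₂-conj′ i j zero i≡0 =
    trans (cong toModel (σ₂-zero i j i≡0)) (toModel-turn i j (z i) _ (toℤ-z i) (fibreOf-turn-zero i j i≡0))
  η₂-conj′ i j (suc k) i≡1+k =
    trans (cong toModel (σ₂-suc i j k i≡1+k)) (toModel-turn i j (z i) _ (toℤ-z i) (fibreOf-turn-suc i j k i≡1+k))

  η₂-conj : ∀ x → toModel (η₂ x) ≡ η₂ᵐ (toModel x)
  η₂-conj (i , j) = η₂-conj′ i j (toℕ i) refl

  η₁≗conj : ∀ x → Relabelling.conj ψ η₁ᵐ x ≡ η₁ x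
  η₁≗conj x = trans (cong fromModel (sym (η₁-conj x))) (fromModel∘toModel (η₁ x))

  η₂≗conj : ∀ x → Relabelling.conj ψ η₂ᵐ x ≡ η₂ x
  η₂≗conj x = trans (cong fromModel (sym (η₂-conj x))) (fromModel∘toModel (η₂ x))

odd⇒suc-double : ∀ k → k % 2 ≡ 1 → k ≡ suc (k ℕ./ 2 ℕ.+ k ℕ./ 2)
odd⇒suc-double k k%2≡1 = begin
  k                             ≡⟨ ℕ.m≡m%n+[m/n]*n k 2 ⟩
  k % 2 ℕ.+ k ℕ./ 2 * 2         ≡⟨ cong (ℕ._+ k ℕ./ 2 * 2) k%2≡1 ⟩
  suc (k ℕ./ 2 * 2)             ≡⟨ cong suc (ℕ.*-comm (k ℕ./ 2) 2) ⟩
  suc (2 * (k ℕ./ 2))           ≡⟨ cong (λ x → suc (k ℕ./ 2 ℕ.+ x)) (ℕ.+-identityʳ (k ℕ./ 2)) ⟩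
  suc (k ℕ./ 2 ℕ.+ k ℕ./ 2)     ∎
  where open ≡-Reasoning

odd*odd : ∀ k l → k % 2 ≡ 1 → l % 2 ≡ 1 → ∃ λ h → k * l ≡ suc (h ℕ.+ h)
odd*odd k l k-odd l-odd =
  p * suc (q ℕ.+ q) ℕ.+ q , trans (cong₂ _*_ (odd⇒suc-double k k-odd) (odd⇒suc-double l l-odd)) (lemma p q)
  where
  p = k ℕ./ 2
  q = l ℕ./ 2
  lemma : ∀ p q → suc (p ℕ.+ p) * suc (q ℕ.+ q) ≡ suc ((p * suc (q ℕ.+ q) ℕ.+ q) ℕ.+ (p * suc (q ℕ.+ q) ℕ.+ q))
  lemma = ℕ-Solver.solve-∀

≤-odd* : ∀ s m → s % 2 ≡ 1 → m ≤ s * m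
≤-odd* s m s-odd = subst (λ k → m ≤ k * m) (sym (odd⇒suc-double s s-odd)) (ℕ.m≤m+n m _)

inverse-of-4 : ∀ m → m % 2 ≡ 1 → ∃ λ ¼ → + 4 · ¼ ≡ 1ℤ mod m
inverse-of-4 m m-odd = + (suc q * suc q) , subst (λ k → + 4 · + (suc q * suc q) ≡ 1ℤ mod k) (sym m≡2q+1)
  (∣⇒≡-mod (divides (M + + 2) refl) (begin
    (M + + 2) · M                      ≡⟨ lemma Q ⟩
    + 4 · ((1ℤ + Q) · (1ℤ + Q)) - 1ℤ   ≡⟨ cong (λ x → + 4 · x - 1ℤ) (ℤ.pos-* (suc q) (suc q)) ⟨
    + 4 · + (suc q * suc q) - 1ℤ       ∎))
  where
  open ≡-Reasoning
  q = m ℕ./ 2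
  m≡2q+1 = odd⇒suc-double m m-odd
  Q = + q
  M = 1ℤ + (Q + Q)
  lemma : ∀ Q → (1ℤ + (Q + Q) + + 2) · (1ℤ + (Q + Q)) ≡ + 4 · ((1ℤ + Q) · (1ℤ + Q)) - 1ℤ
  lemma Q = solve (Q ∷ [])

proposition5p3 : (n m s : ℕ) {{_ : NonZero n}} {{_ : NonZero m}}
    → 3 ≤ m → m % 2 ≡ 1 → s % 2 ≡ 1 → n ≡ s * m
    → ∃ λ (M : Lex.RotSys n m)
      → Lex.Polytopal n m M × Lex.Reflexible n m M × Lex.HasType n m M n (2 * m)
        × Lex.Aut⁺Is n m M (Lex.η₁ n m) (Lex.η₂ n m)
proposition5p3 n m s 3≤m m-odd s-odd n≡s*m =
  M , polytopal model-polytopal , reflexible model-reflexible , hasType model-hasType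
    , aut⁺Is {M} (distinguished-≗ {M} η₁≗conj η₂≗conj (distinguished model-distinguished))
  where
  m∣n : m ℕ.∣ n
  m∣n = ℕ.divides s n≡s*m
  2<n : 2 ℕ.< n
  2<n = ℕ.≤-trans 3≤m (subst (m ≤_) (sym n≡s*m) (≤-odd* s m s-odd))
  open Maps n m using (aut⁺Is; distinguished-≗)
  open Model n m m∣n 2<n (proj₁ (inverse-of-4 m m-odd)) (proj₂ (inverse-of-4 m m-odd))
    using (model; model-polytopal; model-reflexible; model-hasType; model-distinguished)
  open Generators n m m∣n (proj₁ (odd*odd s m s-odd m-odd)) (trans n≡s*m (proj₂ (odd*odd s m s-odd m-odd)))
    using (ψ; η₁≗conj; η₂≗conj)
  open Maps.Pullback n m ψ model
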